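{- For an $R$-labeled poset $P$, the coefficients of the polynomial ${\sf Num}(P;y,t)\in\mathbb{Z}[y,t]$ are nonnegative.
   Context: A graded poset $P$ of rank $n$ is a finite poset with unique minimum $\hat 0$ (rank $0$) and unique maximum $\hat 1$ (rank $n$) such that ${\sf rank}(X)$ equals the length of every maximal chain from $\hat 0$ to $X$. A chain is a (possibly empty) totally ordered subset. For a graded poset $Q$ with minimum $\hat 0_Q$ and Möbius function $\mu$, $\mathrm{Poin}(Q;y)=\sum_{X\in Q}|\mu(\hat 0_Q,X)|\,y^{{\sf rank}_Q(X)}$. For a chain $\mathcal{C}=\{\mathcal{C}_1<\dots<\mathcal{C}_k\}$, $\mathrm{Poin}_{\mathcal{C}}(P;y)=\prod_{i=1}^k\mathrm{Poin}([\mathcal{C}_i,\mathcal{C}_{i+1}];y)$ with $\mathcal{C}_{k+1}=\hat 1$. Define ${\sf Num}(P;y,t)=\sum_{\mathcal{C}}\mathrm{Poin}_{\{\hat 0\}\cup\mathcal{C}}(P;y)\,t^{\#\mathcal{C}}(1-t)^{n-1-\#\mathcal{C}}$, the sum over all chains $\mathcal{C}$ in $P\setminus\{\hat 0,\hat 1\}$. An $R$-labeling of $P$ is a map from cover relations $X\lessdot Y$ to positive integers such that every interval $[X,Y]$ has a unique maximal chain with weakly increasing labels; $P$ is $R$-labeled if it is finite, graded and admits one. -}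

module Defs where

open import Data.Bool using (Bool; true; false; if_then_else_; _∧_; not)
open import Data.Nat as ℕ using (ℕ; zero; suc; _∸_; _≤_)
open import Data.Integer as ℤ using (ℤ; +_; -_; ∣_∣)
open import Data.Fin using (Fin)
open import Data.Fin.Properties using (_≟_)
open import Data.List using (List; []; _∷_; _++_; map; concat; concatMap; filterᵇ; foldr; length)
open import Data.List.Relation.Unary.Linked using (Linked)
open import Data.Product using (_×_; _,_; Σ; ∃)
open import Data.Sum using (_⊎_)
open import Relation.Binary.PropositionalEquality using (_≡_; _≢_)
open import Relation.Nullary.Decidable using (⌊_⌋)

record FinPoset : Set where
  field
    m       : ℕ
    le      : Fin m → Fin m → Bool
    le-refl  : ∀ x → le x x ≡ true
    le-antisym : ∀ x y → le x y ≡ true → le y x ≡ true → x ≡ y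
    le-trans : ∀ x y z → le x y ≡ true → le y z ≡ true → le x z ≡ true

module _ (P : FinPoset) where
  open FinPoset P

  eqᵇ : Fin m → Fin m → Bool
  eqᵇ x y = ⌊ x ≟ y ⌋

  ltᵇ : Fin m → Fin m → Bool
  ltᵇ x y = le x y ∧ not (eqᵇ x y)

  Covers : Fin m → Fin m → Set
  Covers x y = (le x y ≡ true) × (x ≢ y) ×
               (∀ z → le x z ≡ true → le z y ≡ true → (z ≡ x) ⊎ (z ≡ y))

  -- SatChain x zs y : x ⋖ z₁ ⋖ ... ⋖ z_k = y where zs = [z₁,...,z_k]
  -- (a maximal chain of the interval [x,y]); its length is  length zs.
  SatChain : Fin m → List (Fin m) → Fin m → Set
  SatChain x []       y = x ≡ y
  SatChain x (z ∷ zs) y = Covers x z × SatChain z zs y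

  record Graded : Set where
    field
      bot top : Fin m
      bot-min : ∀ x → le bot x ≡ true
      top-max : ∀ x → le x top ≡ true
      rk      : Fin m → ℕ
      rk-chain : ∀ x zs → SatChain bot zs x → length zs ≡ rk x

  labels : (Fin m → Fin m → ℕ) → Fin m → List (Fin m) → List ℕ
  labels λ' x []       = []
  labels λ' x (z ∷ zs) = λ' x z ∷ labels λ' z zs

  IsRLabeling : (Fin m → Fin m → ℕ) → Set
  IsRLabeling λ' =
    (∀ x y → Covers x y → 1 ≤ λ' x y) ×
    (∀ x y → le x y ≡ true →
       Σ (List (Fin m)) λ zs →
         SatChain x zs y × Linked _≤_ (labels λ' x zs) ×
         (∀ ws → SatChain x ws y → Linked _≤_ (labels λ' x ws) → ws ≡ zs))

  RLabeled : Set
  RLabeled = ∃ IsRLabeling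

-- Polynomials in ℤ[y,t] as finite lists of monomials (c , i , j) = c·yⁱ·tʲ

Poly : Set
Poly = List (ℤ × ℕ × ℕ)

polyMul : Poly → Poly → Poly
polyMul p q = concatMap (λ { (c , i , j) → map (λ { (d , k , l) → (c ℤ.* d , i ℕ.+ k , j ℕ.+ l) }) q }) p

polyOne : Poly
polyOne = (+ 1 , 0 , 0) ∷ []

polyProd : List Poly → Poly
polyProd = foldr polyMul polyOne

polyPow : Poly → ℕ → Poly
polyPow p zero    = polyOne
polyPow p (suc k) = polyMul p (polyPow p k)

polyT : Poly
polyT = (+ 1 , 0 , 1) ∷ []

polyOneMinusT : Poly
polyOneMinusT = (+ 1 , 0 , 0) ∷ (- (+ 1) , 0 , 1) ∷ []

coeff : Poly → ℕ → ℕ → ℤ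
coeff []                  a b = + 0
coeff ((c , i , j) ∷ p) a b =
  (if ⌊ i ℕ.≟ a ⌋ ∧ ⌊ j ℕ.≟ b ⌋ then c else + 0) ℤ.+ coeff p a b

sumℤ : List ℤ → ℤ
sumℤ = foldr ℤ._+_ (+ 0)

module _ (P : FinPoset) where
  open FinPoset P

  elems : List (Fin m)
  elems = Data.List.allFin m
    where import Data.List

  -- Möbius function by the usual recursion
  --   μ(x,x) = 1,  μ(x,y) = - Σ_{x ≤ z < y} μ(x,z) for x < y,  μ(x,y) = 0 otherwise,
  -- computed with a fuel parameter (fuel m suffices since chains have < m steps).
  möbiusF : ℕ → Fin m → Fin m → ℤ
  möbiusF zero    x y = + 0
  möbiusF (suc f) x y =
    if eqᵇ P x y then + 1
    else if le x y
      then - sumℤ (map (möbiusF f x) (filterᵇ (λ z → le x z ∧ ltᵇ P z y) elems))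
      else + 0

  möbius : Fin m → Fin m → ℤ
  möbius = möbiusF m

  module _ (G : Graded P) where
    open Graded G

    poinInterval : Fin m → Fin m → Poly
    poinInterval a b =
      map (λ x → (+ ∣ möbius a x ∣ , rk x ∸ rk a , 0))
          (filterᵇ (λ x → le a x ∧ le x b) elems)

    poinChainFrom : Fin m → List (Fin m) → Poly
    poinChainFrom c []       = poinInterval c top
    poinChainFrom c (d ∷ ds) = polyMul (poinInterval c d) (poinChainFrom d ds)

    -- Poin_{{0̂} ∪ C}(P; y) for C given as its increasing list of elements
    poinChain : List (Fin m) → Poly
    poinChain C = poinChainFrom bot C

    chainsAboveF : ℕ → Fin m → List (List (Fin m))
    chainsAboveF zero    c = [] ∷ []
    chainsAboveF (suc f) c =
      [] ∷ concatMap (λ z → map (z ∷_) (chainsAboveF f z))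
             (filterᵇ (λ z → ltᵇ P c z ∧ not (eqᵇ P z top)) elems)

    -- all chains C in P ∖ {0̂,1̂}, each listed once as C₁ < ... < C_k
    chains : List (List (Fin m))
    chains = chainsAboveF m bot

    rankP : ℕ
    rankP = rk top

    Num : Poly
    Num = foldr (λ p q → p ++ q) []
            (map (λ C → polyMul (poinChain C)
                          (polyMul (polyPow polyT (length C))
                                   (polyPow polyOneMinusT (rankP ∸ 1 ∸ length C))))
                 chains)

{-# OPTIONS --safe #-}
module Submission where

-- For an R-labelling, the signed number of maximal chains of [a,x] with strictly decreasing
-- labels satisfies the Möbius recursion: cut each maximal chain of [a,b] into a strictly
-- decreasing and a weakly increasing part; every decreasing chain of [a,x] has exactly one
-- increasing continuation to b, and the splits of a nonempty word cancel in sign. So |μ(a,x)|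
-- counts decreasing chains, and Poin([a,b]) is the sum of poinWord over the label words of the
-- maximal chains of [a,b]. Writing N(c) for the analogue of Num on [c,1̂] and grouping its chains
-- by their least element z,
--   N(c) = Poin(c,1̂) (1−t)^(n−1−rk c) + Σ_{c<z<1̂} Poin(c,z) (1−t)^(rk z−rk c−1) t N(z),
-- and writing every transition weight 1 as t + (1 − t) shows that the sum of numWord over the
-- label words of the maximal chains of [c,1̂] satisfies the same recursion. Finally numWord is a
-- sum of monomials yᵃtᵇ with coefficient 1, and N(0̂) = Num.

open import Defs
open import Function using (_∘_; id)
open import Data.Bool using (Bool; true; false; if_then_else_; _∧_; not; T)
open import Data.Bool.Properties using (∧-conicalˡ; ∧-conicalʳ; ∧-identityʳ; ∧-zeroʳ; ¬-not)
open import Data.Nat as ℕ using (ℕ; zero; suc; _∸_; _≤ᵇ_; _<ᵇ_; _≡ᵇ_)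
import Data.Nat.Properties as ℕₚ
open import Data.Integer as ℤ using (ℤ; +_; -_; _+_; _*_; ∣_∣)
open import Data.Integer using (_≤_)
import Data.Integer.Properties as ℤₚ
open import Algebra.Bundles using (AbelianGroup)
open import Algebra.Properties.Group (AbelianGroup.group ℤₚ.+-0-abelianGroup) using (inverseʳ-unique)
open import Data.Integer.Tactic.RingSolver using (solve-∀)
open import Data.Nat.Tactic.RingSolver using () renaming (solve-∀ to ℕ-solve-∀)
open import Data.Product using (Σ; _×_; _,_; proj₁; proj₂; map₁; uncurry)
open import Data.Sum using (_⊎_; inj₁; inj₂)
open import Data.List using (List; []; _∷_; _++_; map; concat; concatMap; length; filterᵇ; allFin; tabulate; lookup)
import Data.List.Properties as Listₚ
open import Data.List.Relation.Unary.All as All using (All; []; _∷_)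
open import Data.List.Relation.Unary.Linked using (Linked; []; [-]; _∷_)
open import Data.Empty using (⊥; ⊥-elim)
open import Data.Fin as Fin using (Fin)
import Data.Fin.Properties as Finₚ
import Data.List.Relation.Unary.All.Properties as Allₚ
open import Relation.Binary.Bundles using (Setoid)
import Relation.Binary.Reasoning.Setoid
open import Relation.Binary.PropositionalEquality
open import Relation.Nullary using (Dec; yes; no)
open import Relation.Nullary.Decidable using (⌊_⌋; isYes≗does; dec-true; dec-false)

-- Sums over lists

sumMap : {A : Set} → (A → ℤ) → List A → ℤ
sumMap f xs = sumℤ (map f xs)

module _ {A : Set} where

  sumMap-++ : ∀ (f : A → ℤ) xs ys → sumMap f (xs ++ ys) ≡ sumMap f xs + sumMap f ys
  sumMap-++ f []       ys = sym (ℤₚ.+-identityˡ _)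
  sumMap-++ f (x ∷ xs) ys =
    trans (cong (_+_ (f x)) (sumMap-++ f xs ys)) (sym (ℤₚ.+-assoc (f x) _ _))

  sumMap-cong : ∀ {f g : A → ℤ} → (∀ x → f x ≡ g x) → ∀ xs → sumMap f xs ≡ sumMap g xs
  sumMap-cong f≗g xs = cong sumℤ (Listₚ.map-cong f≗g xs)

  sumMap-congAll : ∀ {f g : A → ℤ} {xs} → All (λ x → f x ≡ g x) xs → sumMap f xs ≡ sumMap g xs
  sumMap-congAll []       = refl
  sumMap-congAll (e ∷ es) = cong₂ _+_ e (sumMap-congAll es)

  sumMap-zero : ∀ xs → sumMap (λ (_ : A) → + 0) xs ≡ + 0
  sumMap-zero []       = refl
  sumMap-zero (x ∷ xs) = trans (ℤₚ.+-identityˡ _) (sumMap-zero xs)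

  sumMap-+ : ∀ (f g : A → ℤ) xs → sumMap (λ x → f x + g x) xs ≡ sumMap f xs + sumMap g xs
  sumMap-+ f g []       = refl
  sumMap-+ f g (x ∷ xs) rewrite sumMap-+ f g xs = interchange (f x) (g x) (sumMap f xs) (sumMap g xs)
    where
    interchange : ∀ a b c d → a + b + (c + d) ≡ a + c + (b + d)
    interchange = solve-∀

  sumMap-* : ∀ c (f : A → ℤ) xs → sumMap (λ x → c * f x) xs ≡ c * sumMap f xs
  sumMap-* c f []       = sym (ℤₚ.*-zeroʳ c)
  sumMap-* c f (x ∷ xs) rewrite sumMap-* c f xs = sym (ℤₚ.*-distribˡ-+ c (f x) (sumMap f xs))

  sumMap-neg : ∀ (f : A → ℤ) xs → sumMap (λ x → - f x) xs ≡ - sumMap f xs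
  sumMap-neg f []       = refl
  sumMap-neg f (x ∷ xs) rewrite sumMap-neg f xs = sym (ℤₚ.neg-distrib-+ (f x) (sumMap f xs))

sumMap-map : ∀ {A B : Set} (f : B → ℤ) (g : A → B) xs → sumMap f (map g xs) ≡ sumMap (f ∘ g) xs
sumMap-map f g xs = cong sumℤ (sym (Listₚ.map-∘ xs))

sumMap-concatMap : ∀ {A B : Set} (f : B → ℤ) (g : A → List B) xs →
                   sumMap f (concatMap g xs) ≡ sumMap (sumMap f ∘ g) xs
sumMap-concatMap f g []       = refl
sumMap-concatMap f g (x ∷ xs) =
  trans (sumMap-++ f (g x) (concatMap g xs)) (cong (_+_ (sumMap f (g x))) (sumMap-concatMap f g xs))

sumMap-swap : ∀ {A B : Set} (h : A → B → ℤ) xs ys →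
              sumMap (λ x → sumMap (h x) ys) xs ≡ sumMap (λ y → sumMap (λ x → h x y) xs) ys
sumMap-swap h []       ys = sym (sumMap-zero ys)
sumMap-swap h (x ∷ xs) ys =
  trans (cong (_+_ (sumMap (h x) ys)) (sumMap-swap h xs ys))
        (sym (sumMap-+ (h x) (λ y → sumMap (λ x′ → h x′ y) xs) ys))

false≢true : false ≢ true
false≢true ()

filterᵇ-All : ∀ {A : Set} (p : A → Bool) xs → All (λ x → p x ≡ true) (filterᵇ p xs)
filterᵇ-All p []       = []
filterᵇ-All p (x ∷ xs) with p x in px
... | true  = px ∷ filterᵇ-All p xs
... | false = filterᵇ-All p xs

sumMap-filterᵇ : ∀ {A : Set} (p : A → Bool) (g : A → ℤ) xs →
  sumMap g (filterᵇ p xs) ≡ sumMap (λ x → if p x then g x else + 0) xs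
sumMap-filterᵇ p g []       = refl
sumMap-filterᵇ p g (x ∷ xs) with p x
... | true  = cong (_+_ (g x)) (sumMap-filterᵇ p g xs)
... | false = trans (sumMap-filterᵇ p g xs) (sym (ℤₚ.+-identityˡ _))

sumMap-allFin-delta : ∀ k (h : Fin k → ℤ) i → (∀ j → j ≢ i → h j ≡ + 0) → sumMap h (allFin k) ≡ h i
sumMap-allFin-delta (suc k) h i h≡0 = begin
  h Fin.zero + sumMap h (tabulate Fin.suc)
    ≡⟨ cong (_+_ (h Fin.zero)) (cong sumℤ (Listₚ.map-tabulate Fin.suc h)) ⟩
  h Fin.zero + sumℤ (tabulate (h ∘ Fin.suc))
    ≡⟨ cong (_+_ (h Fin.zero)) (cong sumℤ (Listₚ.map-tabulate id (h ∘ Fin.suc))) ⟨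
  h Fin.zero + sumMap (h ∘ Fin.suc) (allFin k)
    ≡⟨ atIndex i h≡0 ⟩
  h i
    ∎
  where
  open ≡-Reasoning
  atIndex : ∀ i → (∀ j → j ≢ i → h j ≡ + 0) → h Fin.zero + sumMap (h ∘ Fin.suc) (allFin k) ≡ h i
  atIndex Fin.zero    h≡0 = trans (cong (_+_ (h Fin.zero))
    (trans (sumMap-cong (λ j → h≡0 (Fin.suc j) λ ()) (allFin k)) (sumMap-zero (allFin k)))) (ℤₚ.+-identityʳ _)
  atIndex (Fin.suc i) h≡0 = trans (cong (_+ sumMap (h ∘ Fin.suc) (allFin k)) (h≡0 Fin.zero λ ()))
    (trans (ℤₚ.+-identityˡ _)
           (sumMap-allFin-delta k (h ∘ Fin.suc) i (λ j j≢i → h≡0 (Fin.suc j) (j≢i ∘ Finₚ.suc-injective))))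

concatMap-filterᵇ : ∀ {A B : Set} (p : A → Bool) (f : A → List B) xs →
  concatMap f (filterᵇ p xs) ≡ concatMap (λ x → if p x then f x else []) xs
concatMap-filterᵇ p f []       = refl
concatMap-filterᵇ p f (x ∷ xs) with p x
... | true  = cong (f x ++_) (concatMap-filterᵇ p f xs)
... | false = concatMap-filterᵇ p f xs

-- Polynomials up to equality of coefficients

Mono : Set
Mono = ℤ × ℕ × ℕ

monoCoeff : Mono → ℕ → ℕ → ℤ
monoCoeff (c , i , j) a b = if (i ≡ᵇ a) ∧ (j ≡ᵇ b) then c else + 0

coeff≡sumMap : ∀ p a b → coeff p a b ≡ sumMap (λ m → monoCoeff m a b) p
coeff≡sumMap []                a b = refl
coeff≡sumMap ((c , i , j) ∷ p) a b
  rewrite isYes≗does (i ℕ.≟ a) | isYes≗does (j ℕ.≟ b) =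
  cong (_+_ (monoCoeff (c , i , j) a b)) (coeff≡sumMap p a b)

infix 4 _≈_
record _≈_ (p q : Poly) : Set where
  constructor mk≈
  field coeff-≡ : ∀ a b → coeff p a b ≡ coeff q a b
open _≈_

≈-setoid : Setoid _ _
≈-setoid = record
  { Carrier       = Poly
  ; _≈_           = _≈_
  ; isEquivalence = record
    { refl  = mk≈ λ _ _ → refl
    ; sym   = λ e → mk≈ λ a b → sym (coeff-≡ e a b)
    ; trans = λ e f → mk≈ λ a b → trans (coeff-≡ e a b) (coeff-≡ f a b)
    }
  }

open Setoid ≈-setoid public using () renaming (refl to ≈-refl; sym to ≈-sym; trans to ≈-trans)

module ≈-Reasoning = Relation.Binary.Reasoning.Setoid ≈-setoid

≡⇒≈ : ∀ {p q} → p ≡ q → p ≈ q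
≡⇒≈ refl = ≈-refl

infixl 6 _⊕_
_⊕_ : Poly → Poly → Poly
_⊕_ = _++_

infixl 7 _⊛_
_⊛_ : Poly → Poly → Poly
_⊛_ = polyMul

coeff-⊕ : ∀ p q a b → coeff (p ⊕ q) a b ≡ coeff p a b + coeff q a b
coeff-⊕ p q a b rewrite coeff≡sumMap (p ⊕ q) a b | coeff≡sumMap p a b | coeff≡sumMap q a b =
  sumMap-++ _ p q

coeff-concatMap : ∀ {A : Set} (g : A → Poly) xs a b →
                  coeff (concatMap g xs) a b ≡ sumMap (λ x → coeff (g x) a b) xs
coeff-concatMap g xs a b = begin
  coeff (concatMap g xs) a b                           ≡⟨ coeff≡sumMap (concatMap g xs) a b ⟩
  sumMap (λ m → monoCoeff m a b) (concatMap g xs)      ≡⟨ sumMap-concatMap _ g xs ⟩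
  sumMap (sumMap (λ m → monoCoeff m a b) ∘ g) xs       ≡⟨ sumMap-cong (λ x → sym (coeff≡sumMap (g x) a b)) xs ⟩
  sumMap (λ x → coeff (g x) a b) xs                    ∎
  where open ≡-Reasoning

⊕-cong : ∀ {p p′ q q′} → p ≈ p′ → q ≈ q′ → p ⊕ q ≈ p′ ⊕ q′
⊕-cong {p} {p′} {q} {q′} e f = mk≈ λ a b → begin
  coeff (p ⊕ q) a b            ≡⟨ coeff-⊕ p q a b ⟩
  coeff p a b + coeff q a b    ≡⟨ cong₂ _+_ (coeff-≡ e a b) (coeff-≡ f a b) ⟩
  coeff p′ a b + coeff q′ a b  ≡⟨ coeff-⊕ p′ q′ a b ⟨
  coeff (p′ ⊕ q′) a b          ∎
  where open ≡-Reasoning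

⊕-congˡ : ∀ {p p′} q → p ≈ p′ → p ⊕ q ≈ p′ ⊕ q
⊕-congˡ q e = ⊕-cong e ≈-refl

⊕-congʳ : ∀ p {q q′} → q ≈ q′ → p ⊕ q ≈ p ⊕ q′
⊕-congʳ p e = ⊕-cong ≈-refl e

⊕-comm : ∀ p q → p ⊕ q ≈ q ⊕ p
⊕-comm p q = mk≈ λ a b →
  trans (coeff-⊕ p q a b) (trans (ℤₚ.+-comm (coeff p a b) _) (sym (coeff-⊕ q p a b)))

⊕-assoc : ∀ p q r → (p ⊕ q) ⊕ r ≈ p ⊕ (q ⊕ r)
⊕-assoc p q r = ≡⇒≈ (Listₚ.++-assoc p q r)

⊕-identityʳ : ∀ p → p ⊕ [] ≈ p
⊕-identityʳ p = ≡⇒≈ (Listₚ.++-identityʳ p)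

⊕-leftComm : ∀ p q r → p ⊕ (q ⊕ r) ≈ q ⊕ (p ⊕ r)
⊕-leftComm p q r = ≈-trans (≈-sym (⊕-assoc p q r)) (≈-trans (⊕-congˡ r (⊕-comm p q)) (⊕-assoc q p r))

⊕-interchange : ∀ p q r s → (p ⊕ q) ⊕ (r ⊕ s) ≈ (p ⊕ r) ⊕ (q ⊕ s)
⊕-interchange p q r s =
  ≈-trans (⊕-assoc p q _) (≈-trans (⊕-congʳ p (≈-trans (≈-sym (⊕-assoc q r s))
    (≈-trans (⊕-congˡ s (⊕-comm q r)) (⊕-assoc r q s)))) (≈-sym (⊕-assoc p r _)))

concatMap-congAll≈ : ∀ {A : Set} {g h : A → Poly} {xs} → All (λ x → g x ≈ h x) xs →
                     concatMap g xs ≈ concatMap h xs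
concatMap-congAll≈ []       = ≈-refl
concatMap-congAll≈ (e ∷ es) = ⊕-cong e (concatMap-congAll≈ es)

concatMap-cong≈ : ∀ {A : Set} {g h : A → Poly} → (∀ x → g x ≈ h x) → ∀ xs →
                  concatMap g xs ≈ concatMap h xs
concatMap-cong≈ g≈h xs = concatMap-congAll≈ (All.tabulate {xs = xs} (λ {x} _ → g≈h x))

concatMap-vanish : ∀ {A : Set} {f : A → Poly} {xs} → All (λ x → f x ≈ []) xs → concatMap f xs ≈ []
concatMap-vanish []       = ≈-refl
concatMap-vanish (e ∷ es) = ⊕-cong e (concatMap-vanish es)

concatMap-⊕ : ∀ {A : Set} (g h : A → Poly) xs →
              concatMap (λ x → g x ⊕ h x) xs ≈ concatMap g xs ⊕ concatMap h xs
concatMap-⊕ g h []       = ≈-refl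
concatMap-⊕ g h (x ∷ xs) =
  ≈-trans (⊕-congʳ (g x ⊕ h x) (concatMap-⊕ g h xs)) (⊕-interchange (g x) (h x) _ _)

infixl 7 _⊗_
_⊗_ : Mono → Mono → Mono
(c , i , j) ⊗ (d , k , l) = (c * d , i ℕ.+ k , j ℕ.+ l)

⊗-comm : ∀ m n → m ⊗ n ≡ n ⊗ m
⊗-comm (c , i , j) (d , k , l) rewrite ℤₚ.*-comm c d | ℕₚ.+-comm i k | ℕₚ.+-comm j l = refl

⊗-assoc : ∀ m n o → (m ⊗ n) ⊗ o ≡ m ⊗ (n ⊗ o)
⊗-assoc (c , i , j) (d , k , l) (e , u , v)
  rewrite ℤₚ.*-assoc c d e | ℕₚ.+-assoc i k u | ℕₚ.+-assoc j l v = refl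

⊗-identityˡ : ∀ m → (+ 1 , 0 , 0) ⊗ m ≡ m
⊗-identityˡ (d , k , l) = cong (_, k , l) (ℤₚ.*-identityˡ d)

coeff-⊛ : ∀ p q a b → coeff (p ⊛ q) a b ≡ sumMap (λ m → sumMap (λ n → monoCoeff (m ⊗ n) a b) q) p
coeff-⊛ p q a b = begin
  coeff (p ⊛ q) a b                                                    ≡⟨ coeff≡sumMap (p ⊛ q) a b ⟩
  sumMap (λ m → monoCoeff m a b) (concatMap (λ m → map (m ⊗_) q) p)   ≡⟨ sumMap-concatMap _ _ p ⟩
  sumMap (λ m → sumMap (λ m′ → monoCoeff m′ a b) (map (m ⊗_) q)) p
    ≡⟨ sumMap-cong (λ m → sumMap-map _ (m ⊗_) q) p ⟩
  sumMap (λ m → sumMap (λ n → monoCoeff (m ⊗ n) a b) q) p             ∎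
  where open ≡-Reasoning

⊛-comm : ∀ p q → p ⊛ q ≈ q ⊛ p
⊛-comm p q = mk≈ λ a b → begin
  coeff (p ⊛ q) a b                                           ≡⟨ coeff-⊛ p q a b ⟩
  sumMap (λ m → sumMap (λ n → monoCoeff (m ⊗ n) a b) q) p
    ≡⟨ sumMap-cong (λ m → sumMap-cong (λ n → cong (λ z → monoCoeff z a b) (⊗-comm m n)) q) p ⟩
  sumMap (λ m → sumMap (λ n → monoCoeff (n ⊗ m) a b) q) p    ≡⟨ sumMap-swap _ p q ⟩
  sumMap (λ n → sumMap (λ m → monoCoeff (n ⊗ m) a b) p) q    ≡⟨ coeff-⊛ q p a b ⟨
  coeff (q ⊛ p) a b                                           ∎
  where open ≡-Reasoning

+-≡ᵇ-shift : ∀ i k a → (i ℕ.+ k ≡ᵇ a) ≡ (if i ≤ᵇ a then k ≡ᵇ a ∸ i else false)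
+-≡ᵇ-shift zero          k a       = refl
+-≡ᵇ-shift (suc i)       k zero    = refl
+-≡ᵇ-shift (suc zero)    k (suc a) = refl
+-≡ᵇ-shift (suc (suc i)) k (suc a) = +-≡ᵇ-shift (suc i) k a

-- The coefficient of yᵃtᵇ in (c yⁱtʲ) · q is c times that of yᵃ⁻ⁱtᵇ⁻ʲ in q, and 0 if i > a or j > b.
scaledShift : Mono → ℕ → ℕ → ℤ → ℤ
scaledShift (c , i , j) a b x = if (i ≤ᵇ a) ∧ (j ≤ᵇ b) then c * x else + 0

monoCoeff-⊗ : ∀ m n a b →
  monoCoeff (m ⊗ n) a b ≡ scaledShift m a b (monoCoeff n (a ∸ proj₁ (proj₂ m)) (b ∸ proj₂ (proj₂ m)))
monoCoeff-⊗ (c , i , j) (d , k , l) a b rewrite +-≡ᵇ-shift i k a | +-≡ᵇ-shift j l b =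
  cases (i ≤ᵇ a) (j ≤ᵇ b) (k ≡ᵇ a ∸ i) (l ≡ᵇ b ∸ j)
  where
  cases : ∀ p q x y → (if (if p then x else false) ∧ (if q then y else false) then c * d else + 0)
                      ≡ (if p ∧ q then c * (if x ∧ y then d else + 0) else + 0)
  cases false q     x     y     = refl
  cases true  false true  y     = refl
  cases true  false false y     = refl
  cases true  true  true  true  = refl
  cases true  true  true  false = sym (ℤₚ.*-zeroʳ c)
  cases true  true  false y     = sym (ℤₚ.*-zeroʳ c)

monoCoeff-scale : ∀ z k a b → monoCoeff (z , k , 0) a b ≡ monoCoeff (+ 1 , k , 0) a b * z
monoCoeff-scale z k a b with (k ≡ᵇ a) ∧ (0 ≡ᵇ b)
... | true  = sym (ℤₚ.*-identityˡ z)
... | false = refl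

coeff-mono⊛ : ∀ m q a b → sumMap (λ n → monoCoeff (m ⊗ n) a b) q
                          ≡ scaledShift m a b (coeff q (a ∸ proj₁ (proj₂ m)) (b ∸ proj₂ (proj₂ m)))
coeff-mono⊛ m@(c , i , j) q a b = begin
  sumMap (λ n → monoCoeff (m ⊗ n) a b) q
    ≡⟨ sumMap-cong (λ n → monoCoeff-⊗ m n a b) q ⟩
  sumMap (λ n → scaledShift m a b (monoCoeff n (a ∸ i) (b ∸ j))) q
    ≡⟨ sumMap-scaledShift ⟩
  scaledShift m a b (sumMap (λ n → monoCoeff n (a ∸ i) (b ∸ j)) q)
    ≡⟨ cong (scaledShift m a b) (coeff≡sumMap q _ _) ⟨
  scaledShift m a b (coeff q (a ∸ i) (b ∸ j))
    ∎
  where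
  open ≡-Reasoning
  sumMap-scaledShift : sumMap (λ n → scaledShift m a b (monoCoeff n (a ∸ i) (b ∸ j))) q
                       ≡ scaledShift m a b (sumMap (λ n → monoCoeff n (a ∸ i) (b ∸ j)) q)
  sumMap-scaledShift with (i ≤ᵇ a) ∧ (j ≤ᵇ b)
  ... | true  = sumMap-* c _ q
  ... | false = sumMap-zero q

⊛-congʳ : ∀ p {q q′} → q ≈ q′ → p ⊛ q ≈ p ⊛ q′
⊛-congʳ p {q} {q′} e = mk≈ λ a b → begin
  coeff (p ⊛ q) a b
    ≡⟨ coeff-⊛ p q a b ⟩
  sumMap (λ m → sumMap (λ n → monoCoeff (m ⊗ n) a b) q) p
    ≡⟨ sumMap-cong (λ m → coeff-mono⊛ m q a b) p ⟩
  sumMap (λ m → scaledShift m a b (coeff q (a ∸ proj₁ (proj₂ m)) (b ∸ proj₂ (proj₂ m)))) p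
    ≡⟨ sumMap-cong (λ m → cong (scaledShift m a b) (coeff-≡ e _ _)) p ⟩
  sumMap (λ m → scaledShift m a b (coeff q′ (a ∸ proj₁ (proj₂ m)) (b ∸ proj₂ (proj₂ m)))) p
    ≡⟨ sumMap-cong (λ m → coeff-mono⊛ m q′ a b) p ⟨
  sumMap (λ m → sumMap (λ n → monoCoeff (m ⊗ n) a b) q′) p
    ≡⟨ coeff-⊛ p q′ a b ⟨
  coeff (p ⊛ q′) a b
    ∎
  where open ≡-Reasoning

⊛-congˡ : ∀ {p p′} q → p ≈ p′ → p ⊛ q ≈ p′ ⊛ q
⊛-congˡ {p} {p′} q e = ≈-trans (⊛-comm p q) (≈-trans (⊛-congʳ q e) (⊛-comm q p′))

⊛-cong : ∀ {p p′ q q′} → p ≈ p′ → q ≈ q′ → p ⊛ q ≈ p′ ⊛ q′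
⊛-cong {p′ = p′} {q = q} e f = ≈-trans (⊛-congˡ q e) (⊛-congʳ p′ f)

⊛-assoc : ∀ p q r → (p ⊛ q) ⊛ r ≈ p ⊛ (q ⊛ r)
⊛-assoc p q r = mk≈ λ a b → begin
  coeff ((p ⊛ q) ⊛ r) a b
    ≡⟨ coeff-⊛ (p ⊛ q) r a b ⟩
  sumMap (λ mn → sumMap (λ o → monoCoeff (mn ⊗ o) a b) r) (concatMap (λ m → map (m ⊗_) q) p)
    ≡⟨ sumMap-concatMap _ _ p ⟩
  sumMap (λ m → sumMap (λ mn → sumMap (λ o → monoCoeff (mn ⊗ o) a b) r) (map (m ⊗_) q)) p
    ≡⟨ sumMap-cong (λ m → trans (sumMap-map _ (m ⊗_) q)
         (sumMap-cong (λ n → sumMap-cong (λ o → cong (λ z → monoCoeff z a b) (⊗-assoc m n o)) r) q)) p ⟩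
  sumMap (λ m → sumMap (λ n → sumMap (λ o → monoCoeff (m ⊗ (n ⊗ o)) a b) r) q) p
    ≡⟨ sumMap-cong (λ m → trans (sumMap-concatMap _ _ q) (sumMap-cong (λ n → sumMap-map _ (n ⊗_) r) q)) p ⟨
  sumMap (λ m → sumMap (λ no → monoCoeff (m ⊗ no) a b) (concatMap (λ n → map (n ⊗_) r) q)) p
    ≡⟨ coeff-⊛ p (q ⊛ r) a b ⟨
  coeff (p ⊛ (q ⊛ r)) a b
    ∎
  where open ≡-Reasoning

⊛-distribʳ-⊕ : ∀ p p′ q → (p ⊕ p′) ⊛ q ≈ p ⊛ q ⊕ p′ ⊛ q
⊛-distribʳ-⊕ p p′ q = ≡⇒≈ (Listₚ.concatMap-++ _ p p′)

⊛-distribˡ-⊕ : ∀ p q q′ → p ⊛ (q ⊕ q′) ≈ p ⊛ q ⊕ p ⊛ q′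
⊛-distribˡ-⊕ p q q′ = ≈-trans (⊛-comm p (q ⊕ q′))
  (≈-trans (⊛-distribʳ-⊕ q q′ p) (⊕-cong (⊛-comm q p) (⊛-comm q′ p)))

⊛-concatMapˡ : ∀ {A : Set} (g : A → Poly) xs q → concatMap g xs ⊛ q ≈ concatMap (λ x → g x ⊛ q) xs
⊛-concatMapˡ g []       q = ≈-refl
⊛-concatMapˡ g (x ∷ xs) q =
  ≈-trans (⊛-distribʳ-⊕ (g x) (concatMap g xs) q) (⊕-congʳ (g x ⊛ q) (⊛-concatMapˡ g xs q))

⊛-concatMapʳ : ∀ {A : Set} p (g : A → Poly) xs → p ⊛ concatMap g xs ≈ concatMap (λ x → p ⊛ g x) xs
⊛-concatMapʳ p g xs = ≈-trans (⊛-comm p _)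
  (≈-trans (⊛-concatMapˡ g xs p) (concatMap-cong≈ (λ x → ⊛-comm (g x) p) xs))

⊛-identityˡ : ∀ p → polyOne ⊛ p ≈ p
⊛-identityˡ p = mk≈ λ a b → begin
  coeff (polyOne ⊛ p) a b                                   ≡⟨ coeff-⊛ polyOne p a b ⟩
  sumMap (λ n → monoCoeff ((+ 1 , 0 , 0) ⊗ n) a b) p + + 0  ≡⟨ ℤₚ.+-identityʳ _ ⟩
  sumMap (λ n → monoCoeff ((+ 1 , 0 , 0) ⊗ n) a b) p
    ≡⟨ sumMap-cong (λ n → cong (λ z → monoCoeff z a b) (⊗-identityˡ n)) p ⟩
  sumMap (λ n → monoCoeff n a b) p                          ≡⟨ coeff≡sumMap p a b ⟨
  coeff p a b                                               ∎
  where open ≡-Reasoning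

⊛-identityʳ : ∀ p → p ⊛ polyOne ≈ p
⊛-identityʳ p = ≈-trans (⊛-comm p polyOne) (⊛-identityˡ p)

⊛-leftComm : ∀ p q r → p ⊛ (q ⊛ r) ≈ q ⊛ (p ⊛ r)
⊛-leftComm p q r =
  ≈-trans (≈-sym (⊛-assoc p q r)) (≈-trans (⊛-congˡ r (⊛-comm p q)) (⊛-assoc q p r))

⊛-shuffle : ∀ p q r s → p ⊛ (q ⊛ (r ⊛ s)) ≈ (p ⊛ r) ⊛ (q ⊛ s)
⊛-shuffle p q r s = ≈-trans (⊛-congʳ p (⊛-leftComm q r s)) (≈-sym (⊛-assoc p r (q ⊛ s)))

polyPow-+ : ∀ p i j → polyPow p (i ℕ.+ j) ≈ polyPow p i ⊛ polyPow p j
polyPow-+ p zero    j = ≈-sym (⊛-identityˡ _)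
polyPow-+ p (suc i) j = ≈-trans (⊛-congʳ p (polyPow-+ p i j)) (≈-sym (⊛-assoc p _ _))

NonNeg : Poly → Set
NonNeg = All (λ m → + 0 ≤ proj₁ m)

0≤coeff : ∀ {p} → NonNeg p → ∀ a b → + 0 ≤ coeff p a b
0≤coeff {[]}              []       a b = ℤ.+≤+ ℕ.z≤n
0≤coeff {(c , i , j) ∷ p} (h ∷ hs) a b with ⌊ i ℕ.≟ a ⌋ ∧ ⌊ j ℕ.≟ b ⌋
... | true  = ℤₚ.+-mono-≤ h (0≤coeff hs a b)
... | false = ℤₚ.+-mono-≤ (ℤ.+≤+ ℕ.z≤n) (0≤coeff hs a b)

NonNeg-⊕ : ∀ {p q} → NonNeg p → NonNeg q → NonNeg (p ⊕ q)
NonNeg-⊕ = Allₚ.++⁺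

NonNeg-⊛ : ∀ {p q} → NonNeg p → NonNeg q → NonNeg (p ⊛ q)
NonNeg-⊛ []       hq = []
NonNeg-⊛ {m ∷ _} (h ∷ hp) hq =
  NonNeg-⊕ (Allₚ.map⁺ {f = m ⊗_} (All.map (λ {n} → 0≤⊗ {m} {n} h) hq)) (NonNeg-⊛ hp hq)
  where
  0≤⊗ : ∀ {m n} → + 0 ≤ proj₁ m → + 0 ≤ proj₁ n → + 0 ≤ proj₁ (m ⊗ n)
  0≤⊗ {+ c , _} {+ d , _} _ _ = subst (+ 0 ≤_) (ℤₚ.pos-* c d) (ℤ.+≤+ ℕ.z≤n)

NonNeg-concatMap : ∀ {A : Set} {g : A → Poly} → (∀ x → NonNeg (g x)) → ∀ xs → NonNeg (concatMap g xs)
NonNeg-concatMap hg []       = []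
NonNeg-concatMap hg (x ∷ xs) = NonNeg-⊕ (hg x) (NonNeg-concatMap hg xs)

NonNeg-polyOne : NonNeg polyOne
NonNeg-polyOne = ℤ.+≤+ ℕ.z≤n ∷ []

NonNeg-polyT : NonNeg polyT
NonNeg-polyT = ℤ.+≤+ ℕ.z≤n ∷ []

NonNeg-polyPow : ∀ {p} → NonNeg p → ∀ k → NonNeg (polyPow p k)
NonNeg-polyPow hp zero    = NonNeg-polyOne
NonNeg-polyPow hp (suc k) = NonNeg-⊛ hp (NonNeg-polyPow hp k)

polyY : Poly
polyY = (+ 1 , 1 , 0) ∷ []

polyU : Poly
polyU = polyOneMinusT

polyU^ : ℕ → Poly
polyU^ = polyPow polyU

polyIf : Bool → Poly
polyIf b = if b then polyOne else []

polyOne≈T⊕U : polyOne ≈ polyT ⊕ polyU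
polyOne≈T⊕U = mk≈ λ a b → cases (⌊ 0 ℕ.≟ a ⌋ ∧ ⌊ 1 ℕ.≟ b ⌋) (⌊ 0 ℕ.≟ a ⌋ ∧ ⌊ 0 ℕ.≟ b ⌋)
  where
  cases : ∀ p q → (if q then + 1 else + 0) + + 0
                  ≡ (if p then + 1 else + 0) + ((if q then + 1 else + 0) + ((if p then - + 1 else + 0) + + 0))
  cases true  true  = refl
  cases true  false = refl
  cases false true  = refl
  cases false false = refl

NonNeg-polyY : NonNeg polyY
NonNeg-polyY = ℤ.+≤+ ℕ.z≤n ∷ []

-- Splittings of words

splits : {A : Set} → List A → List (List A × List A)
splits []       = ([] , []) ∷ []
splits (x ∷ xs) = ([] , x ∷ xs) ∷ map (map₁ (x ∷_)) (splits xs)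

splits⁺ : {A : Set} → List A → List (List A × List A)
splits⁺ []       = []
splits⁺ (x ∷ xs) = ([] , x ∷ xs) ∷ map (map₁ (x ∷_)) (splits⁺ xs)

cuts : {A : Set} → List A → List (List A × List A)
cuts []       = []
cuts (x ∷ xs) = map (map₁ (x ∷_)) (splits⁺ xs)

isNonEmpty : {A : Set} → List A → Bool
isNonEmpty []      = false
isNonEmpty (_ ∷ _) = true

concatMap-splits⁺ : ∀ {A B : Set} (H : List A × List A → List B) xs →
  concatMap (λ q → if isNonEmpty (proj₂ q) then H q else []) (splits xs) ≡ concatMap H (splits⁺ xs)
concatMap-splits⁺ H []       = refl
concatMap-splits⁺ H (x ∷ xs) = cong (H ([] , x ∷ xs) ++_) (begin
  concatMap (λ q → if isNonEmpty (proj₂ q) then H q else []) (map (map₁ (x ∷_)) (splits xs))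
    ≡⟨ Listₚ.concatMap-map _ (map₁ (x ∷_)) (splits xs) ⟩
  concatMap (λ q → if isNonEmpty (proj₂ q) then H (map₁ (x ∷_) q) else []) (splits xs)
    ≡⟨ concatMap-splits⁺ (H ∘ map₁ (x ∷_)) xs ⟩
  concatMap (H ∘ map₁ (x ∷_)) (splits⁺ xs)
    ≡⟨ Listₚ.concatMap-map H (map₁ (x ∷_)) (splits⁺ xs) ⟨
  concatMap H (map (map₁ (x ∷_)) (splits⁺ xs))
    ∎)
  where open ≡-Reasoning

concatMap-cuts : ∀ {A B : Set} (H : List A × List A → List B) xs →
  concatMap (λ q → if isNonEmpty (proj₁ q) ∧ isNonEmpty (proj₂ q) then H q else []) (splits xs)
  ≡ concatMap H (cuts xs)
concatMap-cuts H []       = refl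
concatMap-cuts H (x ∷ xs) = begin
  concatMap (λ q → if isNonEmpty (proj₁ q) ∧ isNonEmpty (proj₂ q) then H q else []) (map (map₁ (x ∷_)) (splits xs))
    ≡⟨ Listₚ.concatMap-map _ (map₁ (x ∷_)) (splits xs) ⟩
  concatMap (λ q → if isNonEmpty (proj₂ q) then H (map₁ (x ∷_) q) else []) (splits xs)
    ≡⟨ concatMap-splits⁺ (H ∘ map₁ (x ∷_)) xs ⟩
  concatMap (H ∘ map₁ (x ∷_)) (splits⁺ xs)
    ≡⟨ Listₚ.concatMap-map H (map₁ (x ∷_)) (splits⁺ xs) ⟨
  concatMap H (cuts (x ∷ xs))
    ∎
  where open ≡-Reasoning

Word : Set
Word = List ℕ

-- x ≤ y is written as not (y < x), so that both tests below are decided by the same atom y <ᵇ x.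
strictDecᵇ : Word → Bool
strictDecᵇ []          = true
strictDecᵇ (x ∷ [])    = true
strictDecᵇ (x ∷ y ∷ r) = (y <ᵇ x) ∧ strictDecᵇ (y ∷ r)

weakIncᵇ : Word → Bool
weakIncᵇ []          = true
weakIncᵇ (x ∷ [])    = true
weakIncᵇ (x ∷ y ∷ r) = not (y <ᵇ x) ∧ weakIncᵇ (y ∷ r)

Linked⇒weakIncᵇ : ∀ {w} → Linked ℕ._≤_ w → weakIncᵇ w ≡ true
Linked⇒weakIncᵇ []                  = refl
Linked⇒weakIncᵇ [-]                 = refl
Linked⇒weakIncᵇ {x ∷ y ∷ r} (x≤y ∷ l) with y <ᵇ x in y<x
... | true  = ⊥-elim (ℕₚ.≤⇒≯ x≤y (ℕₚ.<ᵇ⇒< y x (subst T (sym y<x) _)))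
... | false = Linked⇒weakIncᵇ l

weakIncᵇ⇒Linked : ∀ w → weakIncᵇ w ≡ true → Linked ℕ._≤_ w
weakIncᵇ⇒Linked []          _ = []
weakIncᵇ⇒Linked (x ∷ [])    _ = [-]
weakIncᵇ⇒Linked (x ∷ y ∷ r) h with weakIncᵇ⇒Linked (y ∷ r) | y <ᵇ x in y<x
... | rest | false = ℕₚ.≮⇒≥ (λ lt → subst T y<x (ℕₚ.<⇒<ᵇ lt)) ∷ rest h

sign : ℕ → ℤ
sign zero    = + 1
sign (suc k) = - sign k

decIncWeight : (ℕ → ℤ) → Word × Word → ℤ
decIncWeight h (v , u) = if strictDecᵇ v ∧ weakIncᵇ u then h (length v) else + 0

signedSplit : Word × Word → ℤ
signedSplit = decIncWeight sign

if-neg : ∀ b z → (if b then - z else + 0) ≡ - (if b then z else + 0)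
if-neg true  z = refl
if-neg false z = refl

signedSplit-∷∷ : ∀ x y v u →
  signedSplit (x ∷ y ∷ v , u) ≡ (if y <ᵇ x then - signedSplit (y ∷ v , u) else + 0)
signedSplit-∷∷ x y v u with y <ᵇ x
... | true  = if-neg (strictDecᵇ (y ∷ v) ∧ weakIncᵇ u) _
... | false = refl

sumMap-signedSplit-∷∷ : ∀ x y ys → sumMap signedSplit (splits (x ∷ y ∷ ys))
  ≡ signedSplit ([] , x ∷ y ∷ ys) + (signedSplit (x ∷ [] , y ∷ ys)
    + sumMap (λ q → if y <ᵇ x then - signedSplit (y ∷ proj₁ q , proj₂ q) else + 0) (splits ys))
sumMap-signedSplit-∷∷ x y ys = begin
  sumMap signedSplit (splits (x ∷ y ∷ ys))
    ≡⟨ cong (_+_ (signedSplit ([] , x ∷ y ∷ ys))) (sumMap-map signedSplit (map₁ (x ∷_)) (splits (y ∷ ys))) ⟩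
  signedSplit ([] , x ∷ y ∷ ys) + (signedSplit (x ∷ [] , y ∷ ys)
    + sumMap (signedSplit ∘ map₁ (x ∷_)) (map (map₁ (y ∷_)) (splits ys)))
    ≡⟨ cong (λ s → signedSplit ([] , x ∷ y ∷ ys) + (signedSplit (x ∷ [] , y ∷ ys) + s))
            (trans (sumMap-map _ (map₁ (y ∷_)) (splits ys))
                   (sumMap-cong (λ q → signedSplit-∷∷ x y (proj₁ q) (proj₂ q)) (splits ys))) ⟩
  signedSplit ([] , x ∷ y ∷ ys) + (signedSplit (x ∷ [] , y ∷ ys)
    + sumMap (λ q → if y <ᵇ x then - signedSplit (y ∷ proj₁ q , proj₂ q) else + 0) (splits ys))
    ∎
  where open ≡-Reasoning

-- If y < x, the contributing splits of x ∷ y ∷ ys are those of y ∷ ys with x prepended to the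
-- decreasing part, with opposite signs; if x ≤ y, only the two splits next to x contribute, and they cancel.
signedSplits-cancel : ∀ x xs → sumMap signedSplit (splits (x ∷ xs)) ≡ + 0
signedSplits-cancel x []       = refl
signedSplits-cancel x (y ∷ ys) = trans (sumMap-signedSplit-∷∷ x y ys) byCases
  where
  open ≡-Reasoning
  S : Word × Word → ℤ
  S q = signedSplit (y ∷ proj₁ q , proj₂ q)
  I = if weakIncᵇ (y ∷ ys) then + 1 else + 0
  ih : I + sumMap S (splits ys) ≡ + 0
  ih = trans (cong (_+_ I) (sym (sumMap-map signedSplit (map₁ (y ∷_)) (splits ys)))) (signedSplits-cancel y ys)
  byCases : signedSplit ([] , x ∷ y ∷ ys) + (signedSplit (x ∷ [] , y ∷ ys)
              + sumMap (λ q → if y <ᵇ x then - S q else + 0) (splits ys)) ≡ + 0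
  byCases with y <ᵇ x
  ... | true  = begin
    + 0 + ((if weakIncᵇ (y ∷ ys) then - + 1 else + 0) + sumMap (λ q → - S q) (splits ys))
      ≡⟨ ℤₚ.+-identityˡ _ ⟩
    (if weakIncᵇ (y ∷ ys) then - + 1 else + 0) + sumMap (λ q → - S q) (splits ys)
      ≡⟨ cong₂ _+_ (if-neg (weakIncᵇ (y ∷ ys)) (+ 1)) (sumMap-neg S (splits ys)) ⟩
    - I + - sumMap S (splits ys)
      ≡⟨ ℤₚ.neg-distrib-+ I _ ⟨
    - (I + sumMap S (splits ys))
      ≡⟨ cong -_ ih ⟩
    + 0
      ∎
  ... | false = begin
    I + ((if weakIncᵇ (y ∷ ys) then - + 1 else + 0) + sumMap (λ _ → + 0) (splits ys))
      ≡⟨ cong (λ s → I + ((if weakIncᵇ (y ∷ ys) then - + 1 else + 0) + s)) (sumMap-zero (splits ys)) ⟩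
    I + ((if weakIncᵇ (y ∷ ys) then - + 1 else + 0) + + 0)
      ≡⟨ cancel (weakIncᵇ (y ∷ ys)) ⟩
    + 0
      ∎
    where
    cancel : ∀ b → (if b then + 1 else + 0) + ((if b then - + 1 else + 0) + + 0) ≡ + 0
    cancel true  = refl
    cancel false = refl

-- Each letter of a word gets a state; true means that it lies in the strictly decreasing part.
yIf : Bool → Poly
yIf true  = polyY
yIf false = polyOne

compatible : Bool → Bool → ℕ → ℕ → Bool
compatible true  true  x y = y <ᵇ x
compatible true  false x y = true
compatible false true  x y = false
compatible false false x y = not (y <ᵇ x)

branch : (Bool → Poly) → (Bool → Poly) → Poly
branch c F = c true ⊛ F true ⊕ c false ⊛ F false

compatibleIf : Bool → ℕ → ℕ → Bool → Poly
compatibleIf s x y s′ = polyIf (compatible s s′ x y)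

follow : Bool → ℕ → ℕ → (Bool → Poly) → Poly
follow s x y = branch (compatibleIf s x y)

branch-cong : ∀ c {F G} → (∀ s → F s ≈ G s) → branch c F ≈ branch c G
branch-cong c F≈G = ⊕-cong (⊛-congʳ (c true) (F≈G true)) (⊛-congʳ (c false) (F≈G false))

branch-⊕ : ∀ c F G → branch c (λ s → F s ⊕ G s) ≈ branch c F ⊕ branch c G
branch-⊕ c F G =
  ≈-trans (⊕-cong (⊛-distribˡ-⊕ (c true) (F true) (G true)) (⊛-distribˡ-⊕ (c false) (F false) (G false)))
          (⊕-interchange (c true ⊛ F true) (c true ⊛ G true) (c false ⊛ F false) (c false ⊛ G false))

branch-⊛ : ∀ c F q → branch c (λ s → F s ⊛ q) ≈ branch c F ⊛ q
branch-⊛ c F q = ≈-sym (≈-trans (⊛-distribʳ-⊕ (c true ⊛ F true) (c false ⊛ F false) q)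
                                (⊕-cong (⊛-assoc (c true) (F true) q) (⊛-assoc (c false) (F false) q)))

branch-concatMap : ∀ {A : Set} c (g : Bool → A → Poly) xs →
  branch c (λ s → concatMap (g s) xs) ≈ concatMap (λ x → branch c (λ s → g s x)) xs
branch-concatMap c g xs =
  ≈-trans (⊕-cong (⊛-concatMapʳ (c true) (g true) xs) (⊛-concatMapʳ (c false) (g false) xs))
          (≈-sym (concatMap-⊕ (λ x → c true ⊛ g true x) (λ x → c false ⊛ g false x) xs))

branch-T⊕U : ∀ c F → branch (λ s → polyT ⊕ c s ⊛ polyU) F ≈ polyT ⊛ (F true ⊕ F false) ⊕ polyU ⊛ branch c F
branch-T⊕U c F = begin
  branch (λ s → polyT ⊕ c s ⊛ polyU) F
    ≈⟨ ⊕-cong (distrib true) (distrib false) ⟩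
  (polyT ⊛ F true ⊕ polyU ⊛ (c true ⊛ F true)) ⊕ (polyT ⊛ F false ⊕ polyU ⊛ (c false ⊛ F false))
    ≈⟨ ⊕-interchange (polyT ⊛ F true) (polyU ⊛ (c true ⊛ F true))
                     (polyT ⊛ F false) (polyU ⊛ (c false ⊛ F false)) ⟩
  (polyT ⊛ F true ⊕ polyT ⊛ F false) ⊕ (polyU ⊛ (c true ⊛ F true) ⊕ polyU ⊛ (c false ⊛ F false))
    ≈⟨ ⊕-cong (⊛-distribˡ-⊕ polyT (F true) (F false))
              (⊛-distribˡ-⊕ polyU (c true ⊛ F true) (c false ⊛ F false)) ⟨
  polyT ⊛ (F true ⊕ F false) ⊕ polyU ⊛ branch c F
    ∎
  where
  open ≈-Reasoning
  distrib : ∀ s → (polyT ⊕ c s ⊛ polyU) ⊛ F s ≈ polyT ⊛ F s ⊕ polyU ⊛ (c s ⊛ F s)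
  distrib s = ≈-trans (⊛-distribʳ-⊕ polyT (c s ⊛ polyU) (F s))
                      (⊕-congʳ (polyT ⊛ F s) (≈-trans (⊛-assoc (c s) polyU (F s)) (⊛-leftComm (c s) polyU (F s))))

decIncTerm : Word × Word → Poly
decIncTerm (v , u) = if strictDecᵇ v ∧ weakIncᵇ u then (+ 1 , length v , 0) ∷ [] else []

coeff-decIncTerm : ∀ q a b → coeff (decIncTerm q) a b ≡ decIncWeight (λ k → monoCoeff (+ 1 , k , 0) a b) q
coeff-decIncTerm (v , u) a b with strictDecᵇ v ∧ weakIncᵇ u
... | true  = trans (coeff≡sumMap ((+ 1 , length v , 0) ∷ []) a b) (ℤₚ.+-identityʳ _)
... | false = refl

poinWord : Word → Poly
poinWord w = concatMap decIncTerm (splits w)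

poinWordFrom : Bool → Word → Poly
poinWordFrom false w        = decIncTerm ([] , w)
poinWordFrom true  []       = []
poinWordFrom true  (x ∷ xs) = concatMap decIncTerm (map (map₁ (x ∷_)) (splits xs))

poinWord-byFirstLetter : ∀ w → poinWord w ≈ poinWordFrom true w ⊕ poinWordFrom false w
poinWord-byFirstLetter []      = ≈-refl
poinWord-byFirstLetter (x ∷ w) = ⊕-comm (poinWordFrom false (x ∷ w)) _

poinWordFrom-[x] : ∀ s x → poinWordFrom s (x ∷ []) ≈ yIf s
poinWordFrom-[x] true  x = ≈-refl
poinWordFrom-[x] false x = ≈-refl

decIncTerm-∷∷ : ∀ x y v u → decIncTerm (x ∷ y ∷ v , u) ≈ polyY ⊛ (polyIf (y <ᵇ x) ⊛ decIncTerm (y ∷ v , u))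
decIncTerm-∷∷ x y v u with y <ᵇ x
... | false = ≈-refl
... | true with strictDecᵇ (y ∷ v) ∧ weakIncᵇ u
...   | true  = ≈-refl
...   | false = ≈-refl

poinWordFrom-∷∷ : ∀ s x y r →
  poinWordFrom s (x ∷ y ∷ r) ≈ yIf s ⊛ follow s x y (λ s′ → poinWordFrom s′ (y ∷ r))
poinWordFrom-∷∷ false x y r with y <ᵇ x
... | true  = ≈-refl
... | false = ≈-sym (≈-trans (⊛-identityˡ _) (⊛-identityˡ _))
poinWordFrom-∷∷ true x y r = begin
  decIncTerm (x ∷ [] , y ∷ r) ⊕ concatMap decIncTerm (map (map₁ (x ∷_)) (map (map₁ (y ∷_)) (splits r)))
    ≈⟨ ⊕-cong headTerm tailTerms ⟩
  polyY ⊛ poinWordFrom false (y ∷ r) ⊕ polyY ⊛ (polyIf (y <ᵇ x) ⊛ poinWordFrom true (y ∷ r))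
    ≈⟨ ⊕-comm (polyY ⊛ poinWordFrom false (y ∷ r)) _ ⟩
  polyY ⊛ (polyIf (y <ᵇ x) ⊛ poinWordFrom true (y ∷ r)) ⊕ polyY ⊛ poinWordFrom false (y ∷ r)
    ≈⟨ ⊛-distribˡ-⊕ polyY (polyIf (y <ᵇ x) ⊛ poinWordFrom true (y ∷ r)) (poinWordFrom false (y ∷ r)) ⟨
  polyY ⊛ (polyIf (y <ᵇ x) ⊛ poinWordFrom true (y ∷ r) ⊕ poinWordFrom false (y ∷ r))
    ≈⟨ ⊛-congʳ polyY (⊕-congʳ (polyIf (y <ᵇ x) ⊛ poinWordFrom true (y ∷ r))
                                (⊛-identityˡ (poinWordFrom false (y ∷ r)))) ⟨
  polyY ⊛ follow true x y (λ s′ → poinWordFrom s′ (y ∷ r))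
    ∎
  where
  open ≈-Reasoning
  headTerm : decIncTerm (x ∷ [] , y ∷ r) ≈ polyY ⊛ poinWordFrom false (y ∷ r)
  headTerm with weakIncᵇ (y ∷ r)
  ... | true  = ≈-refl
  ... | false = ≈-refl
  tailTerms : concatMap decIncTerm (map (map₁ (x ∷_)) (map (map₁ (y ∷_)) (splits r)))
              ≈ polyY ⊛ (polyIf (y <ᵇ x) ⊛ poinWordFrom true (y ∷ r))
  tailTerms = begin
    concatMap decIncTerm (map (map₁ (x ∷_)) (map (map₁ (y ∷_)) (splits r)))
      ≡⟨ Listₚ.concatMap-map decIncTerm (map₁ (x ∷_)) (map (map₁ (y ∷_)) (splits r)) ⟩
    concatMap (decIncTerm ∘ map₁ (x ∷_)) (map (map₁ (y ∷_)) (splits r))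
      ≡⟨ Listₚ.concatMap-map (decIncTerm ∘ map₁ (x ∷_)) (map₁ (y ∷_)) (splits r) ⟩
    concatMap (decIncTerm ∘ map₁ (x ∷_) ∘ map₁ (y ∷_)) (splits r)
      ≈⟨ concatMap-cong≈ (λ q → decIncTerm-∷∷ x y (proj₁ q) (proj₂ q)) (splits r) ⟩
    concatMap (λ q → polyY ⊛ (polyIf (y <ᵇ x) ⊛ decIncTerm (map₁ (y ∷_) q))) (splits r)
      ≡⟨ Listₚ.concatMap-map (λ q → polyY ⊛ (polyIf (y <ᵇ x) ⊛ decIncTerm q)) (map₁ (y ∷_)) (splits r) ⟨
    concatMap (λ q → polyY ⊛ (polyIf (y <ᵇ x) ⊛ decIncTerm q)) (map (map₁ (y ∷_)) (splits r))
      ≈⟨ ⊛-concatMapʳ polyY (λ q → polyIf (y <ᵇ x) ⊛ decIncTerm q) (map (map₁ (y ∷_)) (splits r)) ⟨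
    polyY ⊛ concatMap (λ q → polyIf (y <ᵇ x) ⊛ decIncTerm q) (map (map₁ (y ∷_)) (splits r))
      ≈⟨ ⊛-congʳ polyY (⊛-concatMapʳ (polyIf (y <ᵇ x)) decIncTerm (map (map₁ (y ∷_)) (splits r))) ⟨
    polyY ⊛ (polyIf (y <ᵇ x) ⊛ poinWordFrom true (y ∷ r))
      ∎

weight : Bool → Bool → ℕ → ℕ → Poly
weight s s′ x y = if compatible s s′ x y then polyOne else polyT

weight≈T⊕U : ∀ s s′ x y → weight s s′ x y ≈ polyT ⊕ polyIf (compatible s s′ x y) ⊛ polyU
weight≈T⊕U s s′ x y with compatible s s′ x y
... | true  = ≈-trans polyOne≈T⊕U (⊕-congʳ polyT (≈-sym (⊛-identityˡ polyU)))
... | false = ≈-sym (⊕-identityʳ polyT)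

-- y counts the letters in state true, t the transitions between incompatible states.
numWordFrom : Bool → Word → Poly
numWordFrom s []          = polyOne
numWordFrom s (x ∷ [])    = yIf s
numWordFrom s (x ∷ y ∷ r) = yIf s ⊛ branch (λ s′ → weight s s′ x y) (λ s′ → numWordFrom s′ (y ∷ r))

numWord : Word → Poly
numWord []      = polyOne
numWord (x ∷ w) = numWordFrom true (x ∷ w) ⊕ numWordFrom false (x ∷ w)

NonNeg-yIf : ∀ s → NonNeg (yIf s)
NonNeg-yIf true  = NonNeg-polyY
NonNeg-yIf false = NonNeg-polyOne

NonNeg-weight : ∀ s s′ x y → NonNeg (weight s s′ x y)
NonNeg-weight s s′ x y with compatible s s′ x y
... | true  = NonNeg-polyOne
... | false = NonNeg-polyT

NonNeg-numWordFrom : ∀ s w → NonNeg (numWordFrom s w)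
NonNeg-numWordFrom s []          = NonNeg-polyOne
NonNeg-numWordFrom s (x ∷ [])    = NonNeg-yIf s
NonNeg-numWordFrom s (x ∷ y ∷ r) = NonNeg-⊛ (NonNeg-yIf s)
  (NonNeg-⊕ (NonNeg-⊛ (NonNeg-weight s true x y) (NonNeg-numWordFrom true (y ∷ r)))
            (NonNeg-⊛ (NonNeg-weight s false x y) (NonNeg-numWordFrom false (y ∷ r))))

NonNeg-numWord : ∀ w → NonNeg (numWord w)
NonNeg-numWord []      = NonNeg-polyOne
NonNeg-numWord (x ∷ w) = NonNeg-⊕ (NonNeg-numWordFrom true (x ∷ w)) (NonNeg-numWordFrom false (x ∷ w))

numWordFrom-∷∷ : ∀ s x y r → numWordFrom s (x ∷ y ∷ r)
  ≈ yIf s ⊛ (polyT ⊛ numWord (y ∷ r) ⊕ polyU ⊛ follow s x y (λ s′ → numWordFrom s′ (y ∷ r)))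
numWordFrom-∷∷ s x y r = ⊛-congʳ (yIf s) (≈-trans
  (⊕-cong (⊛-congˡ (numWordFrom true (y ∷ r)) (weight≈T⊕U s true x y))
          (⊛-congˡ (numWordFrom false (y ∷ r)) (weight≈T⊕U s false x y)))
  (branch-T⊕U (compatibleIf s x y) (λ s′ → numWordFrom s′ (y ∷ r))))

poinWordFrom-prepend : ∀ s x y v R →
  yIf s ⊛ (polyU ⊛ (follow s x y (λ s′ → poinWordFrom s′ (y ∷ v)) ⊛ R))
  ≈ poinWordFrom s (x ∷ y ∷ v) ⊛ (polyU ⊛ R)
poinWordFrom-prepend s x y v R =
  ≈-trans (⊛-shuffle (yIf s) polyU _ R) (⊛-congˡ (polyU ⊛ R) (≈-sym (poinWordFrom-∷∷ s x y v)))

cutTerm : (Word → Poly) → Word × Word → Poly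
cutTerm V (v , u) = V v ⊛ (polyU^ (length v ∸ 1) ⊛ (polyT ⊛ numWord u))

cutExpansion : (Word → Poly) → Word → Poly
cutExpansion V w = V w ⊛ polyU^ (length w ∸ 1) ⊕ concatMap (cutTerm V) (cuts w)

follow-poinWords : ∀ s x y r →
  yIf s ⊛ (polyU ⊛ follow s x y (λ s′ → poinWordFrom s′ (y ∷ r) ⊛ polyU^ (length r)))
  ≈ poinWordFrom s (x ∷ y ∷ r) ⊛ polyU^ (suc (length r))
follow-poinWords s x y r = ≈-trans
  (⊛-congʳ (yIf s) (⊛-congʳ polyU
    (branch-⊛ (compatibleIf s x y) (λ s′ → poinWordFrom s′ (y ∷ r)) (polyU^ (length r)))))
  (poinWordFrom-prepend s x y r (polyU^ (length r)))

follow-cutTerms : ∀ s x y r →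
  yIf s ⊛ (polyU ⊛ follow s x y (λ s′ → concatMap (cutTerm (poinWordFrom s′)) (cuts (y ∷ r))))
  ≈ concatMap (cutTerm (poinWordFrom s)) (map (map₁ (x ∷_)) (cuts (y ∷ r)))
follow-cutTerms s x y r = begin
  yIf s ⊛ (polyU ⊛ follow s x y (λ s′ → concatMap (cutTerm (V s′)) (cuts (y ∷ r))))
    ≈⟨ ⊛-congʳ (yIf s) (⊛-congʳ polyU
         (branch-concatMap (compatibleIf s x y) (λ s′ → cutTerm (V s′)) (cuts (y ∷ r)))) ⟩
  yIf s ⊛ (polyU ⊛ concatMap (λ q → follow s x y (λ s′ → cutTerm (V s′) q)) (cuts (y ∷ r)))
    ≈⟨ ⊛-congʳ (yIf s) (⊛-concatMapʳ polyU _ (cuts (y ∷ r))) ⟩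
  yIf s ⊛ concatMap (λ q → polyU ⊛ follow s x y (λ s′ → cutTerm (V s′) q)) (cuts (y ∷ r))
    ≈⟨ ⊛-concatMapʳ (yIf s) _ (cuts (y ∷ r)) ⟩
  concatMap (λ q → yIf s ⊛ (polyU ⊛ follow s x y (λ s′ → cutTerm (V s′) q))) (map (map₁ (y ∷_)) (splits⁺ r))
    ≡⟨ Listₚ.concatMap-map _ (map₁ (y ∷_)) (splits⁺ r) ⟩
  concatMap (λ q → yIf s ⊛ (polyU ⊛ follow s x y (λ s′ → cutTerm (V s′) (map₁ (y ∷_) q)))) (splits⁺ r)
    ≈⟨ concatMap-cong≈ prependCut (splits⁺ r) ⟩
  concatMap (cutTerm (V s) ∘ map₁ (x ∷_) ∘ map₁ (y ∷_)) (splits⁺ r)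
    ≡⟨ Listₚ.concatMap-map (cutTerm (V s) ∘ map₁ (x ∷_)) (map₁ (y ∷_)) (splits⁺ r) ⟨
  concatMap (cutTerm (V s) ∘ map₁ (x ∷_)) (cuts (y ∷ r))
    ≡⟨ Listₚ.concatMap-map (cutTerm (V s)) (map₁ (x ∷_)) (cuts (y ∷ r)) ⟨
  concatMap (cutTerm (V s)) (map (map₁ (x ∷_)) (cuts (y ∷ r)))
    ∎
  where
  open ≈-Reasoning
  V = poinWordFrom
  prependCut : ∀ q → yIf s ⊛ (polyU ⊛ follow s x y (λ s′ → cutTerm (V s′) (map₁ (y ∷_) q)))
                     ≈ cutTerm (V s) (map₁ (x ∷_) (map₁ (y ∷_) q))
  prependCut (v , u) =
    ≈-trans (⊛-congʳ (yIf s) (⊛-congʳ polyU (branch-⊛ (compatibleIf s x y) (λ s′ → V s′ (y ∷ v)) _)))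
            (≈-trans (poinWordFrom-prepend s x y v _)
                     (⊛-congʳ (V s (x ∷ y ∷ v)) (≈-sym (⊛-assoc polyU (polyU^ (length v)) _))))

follow-cutExpansion : ∀ s x y r →
  yIf s ⊛ (polyU ⊛ follow s x y (λ s′ → cutExpansion (poinWordFrom s′) (y ∷ r)))
  ≈ poinWordFrom s (x ∷ y ∷ r) ⊛ polyU^ (suc (length r))
    ⊕ concatMap (cutTerm (poinWordFrom s)) (map (map₁ (x ∷_)) (cuts (y ∷ r)))
follow-cutExpansion s x y r = begin
  yIf s ⊛ (polyU ⊛ follow s x y (λ s′ → A s′ ⊕ B s′))
    ≈⟨ ⊛-congʳ (yIf s) (⊛-congʳ polyU (branch-⊕ (compatibleIf s x y) A B)) ⟩
  yIf s ⊛ (polyU ⊛ (follow s x y A ⊕ follow s x y B))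
    ≈⟨ ⊛-congʳ (yIf s) (⊛-distribˡ-⊕ polyU (follow s x y A) (follow s x y B)) ⟩
  yIf s ⊛ (polyU ⊛ follow s x y A ⊕ polyU ⊛ follow s x y B)
    ≈⟨ ⊛-distribˡ-⊕ (yIf s) (polyU ⊛ follow s x y A) (polyU ⊛ follow s x y B) ⟩
  yIf s ⊛ (polyU ⊛ follow s x y A) ⊕ yIf s ⊛ (polyU ⊛ follow s x y B)
    ≈⟨ ⊕-cong (follow-poinWords s x y r) (follow-cutTerms s x y r) ⟩
  poinWordFrom s (x ∷ y ∷ r) ⊛ polyU^ (suc (length r))
    ⊕ concatMap (cutTerm (poinWordFrom s)) (map (map₁ (x ∷_)) (cuts (y ∷ r)))
    ∎
  where
  open ≈-Reasoning
  A B : Bool → Poly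
  A s′ = poinWordFrom s′ (y ∷ r) ⊛ polyU^ (length r)
  B s′ = concatMap (cutTerm (poinWordFrom s′)) (cuts (y ∷ r))

-- Write every compatible transition weight 1 as t + (1 − t) and expand at the first letter.
numWordFrom-firstCut : ∀ s x xs → numWordFrom s (x ∷ xs) ≈ cutExpansion (poinWordFrom s) (x ∷ xs)
numWordFrom-firstCut s x []      =
  ≈-sym (≈-trans (⊕-identityʳ _) (≈-trans (⊛-identityʳ _) (poinWordFrom-[x] s x)))
numWordFrom-firstCut s x (y ∷ r) = begin
  numWordFrom s (x ∷ y ∷ r)
    ≈⟨ numWordFrom-∷∷ s x y r ⟩
  yIf s ⊛ (polyT ⊛ numWord (y ∷ r) ⊕ polyU ⊛ follow s x y (λ s′ → numWordFrom s′ (y ∷ r)))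
    ≈⟨ ⊛-distribˡ-⊕ (yIf s) (polyT ⊛ numWord (y ∷ r)) _ ⟩
  yIf s ⊛ (polyT ⊛ numWord (y ∷ r)) ⊕ yIf s ⊛ (polyU ⊛ follow s x y (λ s′ → numWordFrom s′ (y ∷ r)))
    ≈⟨ ⊕-cong firstCut (⊛-congʳ (yIf s) (⊛-congʳ polyU (branch-cong (compatibleIf s x y)
         (λ s′ → numWordFrom-firstCut s′ y r)))) ⟩
  firstCutTerm ⊕ yIf s ⊛ (polyU ⊛ follow s x y (λ s′ → cutExpansion (poinWordFrom s′) (y ∷ r)))
    ≈⟨ ⊕-congʳ firstCutTerm (follow-cutExpansion s x y r) ⟩
  firstCutTerm ⊕ (poinWordFrom s (x ∷ y ∷ r) ⊛ polyU^ (suc (length r)) ⊕ laterCutTerms)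
    ≈⟨ ⊕-leftComm firstCutTerm _ laterCutTerms ⟩
  cutExpansion (poinWordFrom s) (x ∷ y ∷ r)
    ∎
  where
  open ≈-Reasoning
  firstCutTerm = cutTerm (poinWordFrom s) (x ∷ [] , y ∷ r)
  laterCutTerms = concatMap (cutTerm (poinWordFrom s)) (map (map₁ (x ∷_)) (cuts (y ∷ r)))
  firstCut : yIf s ⊛ (polyT ⊛ numWord (y ∷ r)) ≈ firstCutTerm
  firstCut = ≈-sym (⊛-cong (poinWordFrom-[x] s x) (⊛-identityˡ _))

numWord-firstCut : ∀ x xs → numWord (x ∷ xs) ≈ cutExpansion poinWord (x ∷ xs)
numWord-firstCut x xs = begin
  numWord (x ∷ xs)
    ≈⟨ ⊕-cong (numWordFrom-firstCut true x xs) (numWordFrom-firstCut false x xs) ⟩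
  (Vt w ⊛ U ⊕ concatMap (cutTerm Vt) cs) ⊕ (Vf w ⊛ U ⊕ concatMap (cutTerm Vf) cs)
    ≈⟨ ⊕-interchange (Vt w ⊛ U) (concatMap (cutTerm Vt) cs) (Vf w ⊛ U) (concatMap (cutTerm Vf) cs) ⟩
  (Vt w ⊛ U ⊕ Vf w ⊛ U) ⊕ (concatMap (cutTerm Vt) cs ⊕ concatMap (cutTerm Vf) cs)
    ≈⟨ ⊕-cong (⊛-distribʳ-⊕ (Vt w) (Vf w) U) (concatMap-⊕ (cutTerm Vt) (cutTerm Vf) cs) ⟨
  (Vt w ⊕ Vf w) ⊛ U ⊕ concatMap (λ q → cutTerm Vt q ⊕ cutTerm Vf q) cs
    ≈⟨ ⊕-cong (⊛-congˡ U (≈-sym (poinWord-byFirstLetter w))) (concatMap-cong≈ joinCut cs) ⟩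
  poinWord w ⊛ U ⊕ concatMap (cutTerm poinWord) cs
    ∎
  where
  open ≈-Reasoning
  w = x ∷ xs
  U = polyU^ (length xs)
  cs = cuts (x ∷ xs)
  Vt = poinWordFrom true
  Vf = poinWordFrom false
  joinCut : ∀ q → cutTerm Vt q ⊕ cutTerm Vf q ≈ cutTerm poinWord q
  joinCut (v , u) = ≈-trans (≈-sym (⊛-distribʳ-⊕ (Vt v) (Vf v) _)) (⊛-congˡ _ (≈-sym (poinWord-byFirstLetter v)))

-- Maximal chains of a graded poset

-- Saturated chains between comparable elements exist in every finite poset; for an R-labelled
-- poset the labelling provides them.
module MaximalChains (P : FinPoset) (G : Graded P)
  (saturate : ∀ x y → FinPoset.le P x y ≡ true → Σ (List (Fin (FinPoset.m P))) λ zs → SatChain P x zs y)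
  where

  open FinPoset P
  open Graded G

  Chain : Set
  Chain = List (Fin m)

  n : ℕ
  n = rk top

  eqᵇ-refl : ∀ x → eqᵇ P x x ≡ true
  eqᵇ-refl x = trans (isYes≗does (x Finₚ.≟ x)) (dec-true (x Finₚ.≟ x) refl)

  eqᵇ-false : ∀ {x y} → x ≢ y → eqᵇ P x y ≡ false
  eqᵇ-false {x} {y} x≢y = trans (isYes≗does (x Finₚ.≟ y)) (dec-false (x Finₚ.≟ y) x≢y)

  eqᵇ-true : ∀ {x y} → eqᵇ P x y ≡ true → x ≡ y
  eqᵇ-true {x} {y} h with x Finₚ.≟ y
  ... | yes x≡y = x≡y

  eqᵇ-false⇒≢ : ∀ {x y} → eqᵇ P x y ≡ false → x ≢ y
  eqᵇ-false⇒≢ {x} x≟x refl = false≢true (trans (sym x≟x) (eqᵇ-refl x))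

  ltᵇ⇒le∧≢ : ∀ {x y} → ltᵇ P x y ≡ true → le x y ≡ true × x ≢ y
  ltᵇ⇒le∧≢ {x} {y} h = ∧-conicalˡ (le x y) _ h , λ
    { refl → false≢true (trans (sym (cong not (eqᵇ-refl x))) (∧-conicalʳ (le x x) _ h)) }

  SatChain⇒le : ∀ {x zs y} → SatChain P x zs y → le x y ≡ true
  SatChain⇒le {x} {[]}     refl     = le-refl x
  SatChain⇒le {x} {z ∷ zs} (c , s) = le-trans x z _ (proj₁ c) (SatChain⇒le s)

  SatChain-++ : ∀ {x zs y ws z} → SatChain P x zs y → SatChain P y ws z → SatChain P x (zs ++ ws) z
  SatChain-++ {zs = []}    refl    t = t
  SatChain-++ {zs = _ ∷ _} (c , s) t = c , SatChain-++ s t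

  rank-SatChain : ∀ {x zs y} → SatChain P x zs y → rk y ≡ rk x ℕ.+ length zs
  rank-SatChain {x} {zs} {y} s with saturate bot x (bot-min x)
  ... | bs , s₀ = begin
    rk y                          ≡⟨ rk-chain y (bs ++ zs) (SatChain-++ s₀ s) ⟨
    length (bs ++ zs)             ≡⟨ Listₚ.length-++ bs ⟩
    length bs ℕ.+ length zs       ≡⟨ cong (ℕ._+ length zs) (rk-chain x bs s₀) ⟩
    rk x ℕ.+ length zs            ∎
    where open ≡-Reasoning

  rk-bot : rk bot ≡ 0
  rk-bot = sym (rk-chain bot [] refl)

  length-SatChain : ∀ {x zs y} → SatChain P x zs y → length zs ≡ rk y ∸ rk x
  length-SatChain {x} {zs} s = sym (trans (cong (_∸ rk x) (rank-SatChain s)) (ℕₚ.m+n∸m≡n (rk x) (length zs)))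

  rk-mono : ∀ {x y} → le x y ≡ true → rk x ℕ.≤ rk y
  rk-mono {x} {y} x≤y = subst (rk x ℕ.≤_) (sym (rank-SatChain (proj₂ (saturate x y x≤y)))) (ℕₚ.m≤m+n _ _)

  rk-injective-≤ : ∀ {x y} → le x y ≡ true → rk x ≡ rk y → x ≡ y
  rk-injective-≤ {x} {y} x≤y rx≡ry with saturate x y x≤y
  ... | []     , s = s
  ... | z ∷ zs , s = ⊥-elim (ℕₚ.m+1+n≢m (rk x) (sym (trans rx≡ry (rank-SatChain s))))

  rk-strictMono : ∀ {x y} → le x y ≡ true → x ≢ y → rk x ℕ.< rk y
  rk-strictMono x≤y x≢y = ℕₚ.≤∧≢⇒< (rk-mono x≤y) (x≢y ∘ rk-injective-≤ x≤y)

  rk≤n : ∀ x → rk x ℕ.≤ n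
  rk≤n x = rk-mono (top-max x)

  rk<n : ∀ {x} → x ≢ top → rk x ℕ.< n
  rk<n = rk-strictMono (top-max _)

  SatChain-∷⇒≢ : ∀ {a b w zs} → SatChain P a (w ∷ zs) b → a ≢ b
  SatChain-∷⇒≢ {a} s refl = ℕₚ.m+1+n≢m (rk a) (sym (rank-SatChain s))

  coversᵇ : Fin m → Fin m → Bool
  coversᵇ x y = le x y ∧ (rk y ≡ᵇ suc (rk x))

  coversᵇ⇒rk : ∀ {x y} → coversᵇ x y ≡ true → rk y ≡ suc (rk x)
  coversᵇ⇒rk {x} {y} h = ℕₚ.≡ᵇ⇒≡ _ _ (subst T (sym (∧-conicalʳ (le x y) _ h)) _)

  coversᵇ-sound : ∀ {x y} → coversᵇ x y ≡ true → Covers P x y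
  coversᵇ-sound {x} {y} h = x≤y , x≢y , between
    where
    x≤y = ∧-conicalˡ (le x y) _ h
    ry≡ = coversᵇ⇒rk h
    x≢y : x ≢ y
    x≢y refl = ℕₚ.<⇒≢ (ℕₚ.n<1+n (rk x)) ry≡
    between : ∀ z → le x z ≡ true → le z y ≡ true → (z ≡ x) ⊎ (z ≡ y)
    between z x≤z z≤y with rk z ℕ.≟ rk x
    ... | yes rz≡rx = inj₁ (sym (rk-injective-≤ x≤z (sym rz≡rx)))
    ... | no  rz≢rx = inj₂ (rk-injective-≤ z≤y (ℕₚ.≤-antisym (rk-mono z≤y)
            (subst (ℕ._≤ rk z) (sym ry≡) (ℕₚ.≤∧≢⇒< (rk-mono x≤z) (rz≢rx ∘ sym)))))

  coversᵇ-complete : ∀ {x y} → Covers P x y → coversᵇ x y ≡ true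
  coversᵇ-complete {x} {y} c = cong₂ _∧_ (proj₁ c)
    (T⇒≡true (ℕₚ.≡⇒≡ᵇ _ _ (trans (rank-SatChain {zs = y ∷ []} (c , refl)) (ℕₚ.+-comm (rk x) 1))))
    where
    T⇒≡true : ∀ {b} → T b → b ≡ true
    T⇒≡true {true} _ = refl

  upperCovers : Fin m → List (Fin m)
  upperCovers a = filterᵇ (coversᵇ a) (elems P)

  trivialChains : Fin m → Fin m → List Chain
  trivialChains a b = if eqᵇ P a b then [] ∷ [] else []

  maxChainsF : ℕ → Fin m → Fin m → List Chain
  maxChainsF zero    a b = []
  maxChainsF (suc f) a b = trivialChains a b ++ concatMap (λ w → map (w ∷_) (maxChainsF f w b)) (upperCovers a)

  -- A chain starting at a has at most n ∸ rk a steps, which bounds the recursion.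
  maxChains : Fin m → Fin m → List Chain
  maxChains a b = maxChainsF (suc (n ∸ rk a)) a b

  n∸rk-cover : ∀ {a w} → coversᵇ a w ≡ true → n ∸ rk a ≡ suc (n ∸ rk w)
  n∸rk-cover {a} {w} h rewrite coversᵇ⇒rk h = ℕₚ.+-∸-assoc 1 (subst (ℕ._≤ n) (coversᵇ⇒rk h) (rk≤n w))

  maxChains-unfold : ∀ a b →
    maxChains a b ≡ trivialChains a b ++ concatMap (λ w → map (w ∷_) (maxChains w b)) (upperCovers a)
  maxChains-unfold a b = cong (trivialChains a b ++_) (cong concat (Listₚ.map-cong-local
    (All.map (λ {w} h → cong (λ f → map (w ∷_) (maxChainsF f w b)) (n∸rk-cover h))
             (filterᵇ-All (coversᵇ a) (elems P)))))

  maxChainsF-SatChain : ∀ f a b → All (λ zs → SatChain P a zs b) (maxChainsF f a b)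
  maxChainsF-SatChain zero    a b = []
  maxChainsF-SatChain (suc f) a b = Allₚ.++⁺ trivial (Allₚ.concat⁺ (Allₚ.map⁺
      (All.map (λ {w} h → Allₚ.map⁺ (All.map (coversᵇ-sound h ,_) (maxChainsF-SatChain f w b)))
        (filterᵇ-All (coversᵇ a) (elems P)))))
    where
    trivial : All (λ zs → SatChain P a zs b) (trivialChains a b)
    trivial with eqᵇ P a b in a≡b
    ... | true  = eqᵇ-true a≡b ∷ []
    ... | false = []

  maxChains-SatChain : ∀ a b → All (λ zs → SatChain P a zs b) (maxChains a b)
  maxChains-SatChain a b = maxChainsF-SatChain (suc (n ∸ rk a)) a b

  sumMap-maxChains-vanish : ∀ {a b} (F : Chain → ℤ) → (∀ zs → SatChain P a zs b → F zs ≡ + 0) →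
                            sumMap F (maxChains a b) ≡ + 0
  sumMap-maxChains-vanish {a} {b} F F≡0 =
    trans (sumMap-congAll (All.map (λ {zs} → F≡0 zs) (maxChains-SatChain a b))) (sumMap-zero (maxChains a b))

  maxChains-≰ : ∀ {a b} → le a b ≢ true → maxChains a b ≡ []
  maxChains-≰ {a} {b} a≰b = empty (maxChains-SatChain a b)
    where
    empty : ∀ {xss} → All (λ zs → SatChain P a zs b) xss → xss ≡ []
    empty []      = refl
    empty (s ∷ _) = ⊥-elim (a≰b (SatChain⇒le s))

  sumMap-maxChains-unique : ∀ {a b} zs₀ → SatChain P a zs₀ b → (F : Chain → ℤ) →
    (∀ zs → SatChain P a zs b → zs ≢ zs₀ → F zs ≡ + 0) → sumMap F (maxChains a b) ≡ F zs₀
  sumMap-maxChains-unique {a} {.a} [] refl F F≡0 rewrite maxChains-unfold a a | eqᵇ-refl a =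
    trans (cong (_+_ (F [])) (sumMap-vanish (Allₚ.concat⁺ (Allₚ.map⁺
      (All.map (λ {w} h → Allₚ.map⁺ (All.map (λ {zs} s → F≡0 (w ∷ zs) (coversᵇ-sound h , s) λ ())
                                             (maxChains-SatChain w a)))
               (filterᵇ-All (coversᵇ a) (elems P)))))))
      (ℤₚ.+-identityʳ _)
    where
    sumMap-vanish : ∀ {xss} → All (λ zs → F zs ≡ + 0) xss → sumMap F xss ≡ + 0
    sumMap-vanish {xss} h = trans (sumMap-congAll h) (sumMap-zero xss)
  sumMap-maxChains-unique {a} {b} (w₀ ∷ zs₀) (c₀ , s₀) F F≡0
    rewrite maxChains-unfold a b | eqᵇ-false (SatChain-∷⇒≢ {zs = zs₀} (c₀ , s₀)) = begin
    sumMap F (concatMap (λ w → map (w ∷_) (maxChains w b)) (upperCovers a))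
      ≡⟨ sumMap-concatMap F _ (upperCovers a) ⟩
    sumMap (λ w → sumMap F (map (w ∷_) (maxChains w b))) (upperCovers a)
      ≡⟨ sumMap-filterᵇ (coversᵇ a) _ (elems P) ⟩
    sumMap (λ w → if coversᵇ a w then sumMap F (map (w ∷_) (maxChains w b)) else + 0) (elems P)
      ≡⟨ sumMap-allFin-delta m _ w₀ others ⟩
    (if coversᵇ a w₀ then sumMap F (map (w₀ ∷_) (maxChains w₀ b)) else + 0)
      ≡⟨ cong (if_then sumMap F (map (w₀ ∷_) (maxChains w₀ b)) else + 0) (coversᵇ-complete c₀) ⟩
    sumMap F (map (w₀ ∷_) (maxChains w₀ b))
      ≡⟨ sumMap-map F (w₀ ∷_) (maxChains w₀ b) ⟩
    sumMap (F ∘ (w₀ ∷_)) (maxChains w₀ b)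
      ≡⟨ sumMap-maxChains-unique zs₀ s₀ (F ∘ (w₀ ∷_))
           (λ zs s zs≢ → F≡0 (w₀ ∷ zs) (c₀ , s) (zs≢ ∘ Listₚ.∷-injectiveʳ)) ⟩
    F (w₀ ∷ zs₀)
      ∎
    where
    open ≡-Reasoning
    others : ∀ w → w ≢ w₀ → (if coversᵇ a w then sumMap F (map (w ∷_) (maxChains w b)) else + 0) ≡ + 0
    others w w≢w₀ with coversᵇ a w in a⋖w
    ... | false = refl
    ... | true  = trans (sumMap-map F (w ∷_) (maxChains w b))
      (sumMap-maxChains-vanish (F ∘ (w ∷_))
        (λ zs s → F≡0 (w ∷ zs) (coversᵇ-sound a⋖w , s) (w≢w₀ ∘ Listₚ.∷-injectiveˡ)))

  rk-lookup : ∀ {a zs b} → SatChain P a zs b → (i : Fin (length (a ∷ zs))) →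
              rk (lookup (a ∷ zs) i) ≡ rk a ℕ.+ Fin.toℕ i
  rk-lookup {a}          s       Fin.zero    = sym (ℕₚ.+-identityʳ (rk a))
  rk-lookup {a} {z ∷ zs} (c , s) (Fin.suc i) = begin
    rk (lookup (z ∷ zs) i)       ≡⟨ rk-lookup s i ⟩
    rk z ℕ.+ Fin.toℕ i
      ≡⟨ cong (ℕ._+ Fin.toℕ i) (trans (rank-SatChain {zs = z ∷ []} (c , refl)) (ℕₚ.+-comm (rk a) 1)) ⟩
    suc (rk a) ℕ.+ Fin.toℕ i     ≡⟨ ℕₚ.+-suc (rk a) (Fin.toℕ i) ⟨
    rk a ℕ.+ suc (Fin.toℕ i)     ∎
    where open ≡-Reasoning

  -- The elements of a saturated chain have distinct ranks, hence are distinct elements of Fin m.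
  length-SatChain<m : ∀ {a zs b} → SatChain P a zs b → length zs ℕ.< m
  length-SatChain<m {a} {zs} s with suc (length zs) ℕ.≤? m
  ... | yes fits = fits
  ... | no ¬fits with Finₚ.pigeonhole (ℕₚ.≰⇒> ¬fits) (lookup (a ∷ zs))
  ...   | i , j , i<j , same = ⊥-elim (ℕₚ.<⇒≢ i<j (ℕₚ.+-cancelˡ-≡ (rk a) _ _
            (trans (sym (rk-lookup s i)) (trans (cong rk same) (rk-lookup s j)))))

  sumOverSplits : (Chain → Chain → ℤ) → Fin m → Fin m → ℤ
  sumOverSplits F a b = sumMap (λ M → sumMap (uncurry F) (splits M)) (maxChains a b)

  sumOverMiddle : (Chain → Chain → ℤ) → Fin m → Fin m → ℤ
  sumOverMiddle F a b = sumMap (λ x → sumMap (λ e → sumMap (F e) (maxChains x b)) (maxChains a x)) (elems P)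

  sumMap-trivialChains : ∀ a b (g : Chain → ℤ) → sumMap g (trivialChains a b) ≡ (if eqᵇ P a b then g [] + + 0 else + 0)
  sumMap-trivialChains a b g with eqᵇ P a b
  ... | true  = refl
  ... | false = refl

  sumOverSplits-unfold : ∀ F a b → sumOverSplits F a b
    ≡ sumMap (F []) (maxChains a b) + sumMap (λ w → sumOverSplits (F ∘ (w ∷_)) w b) (upperCovers a)
  sumOverSplits-unfold F a b = begin
    sumMap Φ (maxChains a b)
      ≡⟨ cong (sumMap Φ) (maxChains-unfold a b) ⟩
    sumMap Φ (trivialChains a b ++ longer)
      ≡⟨ sumMap-++ Φ (trivialChains a b) longer ⟩
    sumMap Φ (trivialChains a b) + sumMap Φ longer
      ≡⟨ cong₂ _+_ trivialPart longerPart ⟩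
    sumMap (F []) (trivialChains a b) + (sumMap (F []) longer + rest)
      ≡⟨ ℤₚ.+-assoc (sumMap (F []) (trivialChains a b)) _ _ ⟨
    sumMap (F []) (trivialChains a b) + sumMap (F []) longer + rest
      ≡⟨ cong (_+ rest) (trans (cong (sumMap (F [])) (maxChains-unfold a b)) (sumMap-++ (F []) (trivialChains a b) longer)) ⟨
    sumMap (F []) (maxChains a b) + rest
      ∎
    where
    open ≡-Reasoning
    Φ : Chain → ℤ
    Φ M = sumMap (uncurry F) (splits M)
    longer = concatMap (λ w → map (w ∷_) (maxChains w b)) (upperCovers a)
    rest = sumMap (λ w → sumOverSplits (F ∘ (w ∷_)) w b) (upperCovers a)
    trivialPart : sumMap Φ (trivialChains a b) ≡ sumMap (F []) (trivialChains a b)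
    trivialPart rewrite sumMap-trivialChains a b Φ | sumMap-trivialChains a b (F []) with eqᵇ P a b
    ... | true  = cong (_+ + 0) (ℤₚ.+-identityʳ (F [] []))
    ... | false = refl
    Φ-∷ : ∀ w M → Φ (w ∷ M) ≡ F [] (w ∷ M) + sumMap (uncurry (F ∘ (w ∷_))) (splits M)
    Φ-∷ w M = cong (_+_ (F [] (w ∷ M))) (sumMap-map (uncurry F) (map₁ (w ∷_)) (splits M))
    longerPart : sumMap Φ longer ≡ sumMap (F []) longer + rest
    longerPart = begin
      sumMap Φ longer
        ≡⟨ sumMap-concatMap Φ _ (upperCovers a) ⟩
      sumMap (λ w → sumMap Φ (map (w ∷_) (maxChains w b))) (upperCovers a)
        ≡⟨ sumMap-cong (λ w → trans (sumMap-map Φ (w ∷_) (maxChains w b))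
             (trans (sumMap-cong (Φ-∷ w) (maxChains w b)) (sumMap-+ _ _ (maxChains w b)))) (upperCovers a) ⟩
      sumMap (λ w → sumMap (F [] ∘ (w ∷_)) (maxChains w b) + sumOverSplits (F ∘ (w ∷_)) w b) (upperCovers a)
        ≡⟨ sumMap-+ _ _ (upperCovers a) ⟩
      sumMap (λ w → sumMap (F [] ∘ (w ∷_)) (maxChains w b)) (upperCovers a) + rest
        ≡⟨ cong (_+ rest) (trans (sumMap-concatMap (F []) _ (upperCovers a))
             (sumMap-cong (λ w → sumMap-map (F []) (w ∷_) (maxChains w b)) (upperCovers a))) ⟨
      sumMap (F []) longer + rest
        ∎

  sumOverMiddle-unfold : ∀ F a b → sumOverMiddle F a b
    ≡ sumMap (F []) (maxChains a b) + sumMap (λ w → sumOverMiddle (F ∘ (w ∷_)) w b) (upperCovers a)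
  sumOverMiddle-unfold F a b = begin
    sumMap (λ x → sumMap (Ψ x) (maxChains a x)) (elems P)
      ≡⟨ sumMap-cong (λ x → trans (cong (sumMap (Ψ x)) (maxChains-unfold a x))
                                  (sumMap-++ (Ψ x) (trivialChains a x) (longer x))) (elems P) ⟩
    sumMap (λ x → sumMap (Ψ x) (trivialChains a x) + sumMap (Ψ x) (longer x)) (elems P)
      ≡⟨ sumMap-+ _ _ (elems P) ⟩
    sumMap (λ x → sumMap (Ψ x) (trivialChains a x)) (elems P) + sumMap (λ x → sumMap (Ψ x) (longer x)) (elems P)
      ≡⟨ cong₂ _+_ trivialPart longerPart ⟩
    sumMap (F []) (maxChains a b) + sumMap (λ w → sumOverMiddle (F ∘ (w ∷_)) w b) (upperCovers a)
      ∎
    where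
    open ≡-Reasoning
    Ψ : Fin m → Chain → ℤ
    Ψ x e = sumMap (F e) (maxChains x b)
    longer : Fin m → List Chain
    longer x = concatMap (λ w → map (w ∷_) (maxChains w x)) (upperCovers a)
    trivialPart : sumMap (λ x → sumMap (Ψ x) (trivialChains a x)) (elems P) ≡ sumMap (F []) (maxChains a b)
    trivialPart = begin
      sumMap (λ x → sumMap (Ψ x) (trivialChains a x)) (elems P)
        ≡⟨ sumMap-allFin-delta m _ a (λ x x≢a → trans (sumMap-trivialChains a x (Ψ x))
             (cong (if_then Ψ x [] + + 0 else + 0) (eqᵇ-false (x≢a ∘ sym)))) ⟩
      sumMap (Ψ a) (trivialChains a a)
        ≡⟨ sumMap-trivialChains a a (Ψ a) ⟩
      (if eqᵇ P a a then Ψ a [] + + 0 else + 0)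
        ≡⟨ cong (if_then Ψ a [] + + 0 else + 0) (eqᵇ-refl a) ⟩
      Ψ a [] + + 0
        ≡⟨ ℤₚ.+-identityʳ _ ⟩
      sumMap (F []) (maxChains a b)
        ∎
    longerPart : sumMap (λ x → sumMap (Ψ x) (longer x)) (elems P)
                 ≡ sumMap (λ w → sumOverMiddle (F ∘ (w ∷_)) w b) (upperCovers a)
    longerPart = begin
      sumMap (λ x → sumMap (Ψ x) (longer x)) (elems P)
        ≡⟨ sumMap-cong (λ x → trans (sumMap-concatMap (Ψ x) _ (upperCovers a))
             (sumMap-cong (λ w → sumMap-map (Ψ x) (w ∷_) (maxChains w x)) (upperCovers a))) (elems P) ⟩
      sumMap (λ x → sumMap (λ w → sumMap (Ψ x ∘ (w ∷_)) (maxChains w x)) (upperCovers a)) (elems P)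
        ≡⟨ sumMap-swap (λ x w → sumMap (Ψ x ∘ (w ∷_)) (maxChains w x)) (elems P) (upperCovers a) ⟩
      sumMap (λ w → sumOverMiddle (F ∘ (w ∷_)) w b) (upperCovers a)
        ∎

  -- Cutting a maximal chain of [a,b] at one of its elements x gives maximal chains of [a,x] and [x,b].
  sumOverSplits≡sumOverMiddle : ∀ F a b → sumOverSplits F a b ≡ sumOverMiddle F a b
  sumOverSplits≡sumOverMiddle F a b = byFuel (suc (n ∸ rk a)) a (ℕₚ.n<1+n _) F
    where
    byFuel : ∀ k a → n ∸ rk a ℕ.< k → ∀ F → sumOverSplits F a b ≡ sumOverMiddle F a b
    byFuel (suc k) a fuel F = begin
      sumOverSplits F a b
        ≡⟨ sumOverSplits-unfold F a b ⟩
      sumMap (F []) (maxChains a b) + sumMap (λ w → sumOverSplits (F ∘ (w ∷_)) w b) (upperCovers a)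
        ≡⟨ cong (_+_ (sumMap (F []) (maxChains a b))) (sumMap-congAll
             (All.map (λ {w} a⋖w → byFuel k w (fuel′ a⋖w) (F ∘ (w ∷_))) (filterᵇ-All (coversᵇ a) (elems P)))) ⟩
      sumMap (F []) (maxChains a b) + sumMap (λ w → sumOverMiddle (F ∘ (w ∷_)) w b) (upperCovers a)
        ≡⟨ sumOverMiddle-unfold F a b ⟨
      sumOverMiddle F a b
        ∎
      where
      open ≡-Reasoning
      fuel′ : ∀ {w} → coversᵇ a w ≡ true → n ∸ rk w ℕ.< k
      fuel′ a⋖w = ℕₚ.≤-pred (subst (ℕ._< suc k) (n∸rk-cover a⋖w) fuel)

  concatOverSplits : (Chain → Chain → Poly) → Fin m → Fin m → Poly
  concatOverSplits F a b = concatMap (λ M → concatMap (uncurry F) (splits M)) (maxChains a b)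

  concatOverMiddle : (Chain → Chain → Poly) → Fin m → Fin m → Poly
  concatOverMiddle F a b = concatMap (λ x → concatMap (λ e → concatMap (F e) (maxChains x b)) (maxChains a x)) (elems P)

  concatOverSplits≈concatOverMiddle : ∀ F a b → concatOverSplits F a b ≈ concatOverMiddle F a b
  concatOverSplits≈concatOverMiddle F a b = mk≈ λ i j → begin
    coeff (concatOverSplits F a b) i j
      ≡⟨ coeff-concatMap _ (maxChains a b) i j ⟩
    sumMap (λ M → coeff (concatMap (uncurry F) (splits M)) i j) (maxChains a b)
      ≡⟨ sumMap-cong (λ M → coeff-concatMap (uncurry F) (splits M) i j) (maxChains a b) ⟩
    sumOverSplits (λ e u → coeff (F e u) i j) a b
      ≡⟨ sumOverSplits≡sumOverMiddle (λ e u → coeff (F e u) i j) a b ⟩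
    sumOverMiddle (λ e u → coeff (F e u) i j) a b
      ≡⟨ sumMap-cong (λ x → trans (coeff-concatMap _ (maxChains a x) i j)
           (sumMap-cong (λ e → coeff-concatMap (F e) (maxChains x b) i j) (maxChains a x))) (elems P) ⟨
    sumMap (λ x → coeff (concatMap (λ e → concatMap (F e) (maxChains x b)) (maxChains a x)) i j) (elems P)
      ≡⟨ coeff-concatMap _ (elems P) i j ⟨
    coeff (concatOverMiddle F a b) i j
      ∎
    where open ≡-Reasoning

-- R-labelled posets

module RLabelled (P : FinPoset) (G : Graded P)
  (ℓ : Fin (FinPoset.m P) → Fin (FinPoset.m P) → ℕ) (isR : IsRLabeling P ℓ) where

  open FinPoset P
  open Graded G

  increasingChain : ∀ x y → le x y ≡ true → List (Fin m)
  increasingChain x y x≤y = proj₁ (proj₂ isR x y x≤y)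

  increasingChain-SatChain : ∀ x y x≤y → SatChain P x (increasingChain x y x≤y) y
  increasingChain-SatChain x y x≤y = proj₁ (proj₂ (proj₂ isR x y x≤y))

  increasingChain-increasing : ∀ x y x≤y → Linked ℕ._≤_ (labels P ℓ x (increasingChain x y x≤y))
  increasingChain-increasing x y x≤y = proj₁ (proj₂ (proj₂ (proj₂ isR x y x≤y)))

  increasingChain-unique : ∀ x y x≤y zs → SatChain P x zs y → Linked ℕ._≤_ (labels P ℓ x zs) →
                           zs ≡ increasingChain x y x≤y
  increasingChain-unique x y x≤y = proj₂ (proj₂ (proj₂ (proj₂ isR x y x≤y)))

  open MaximalChains P G (λ x y x≤y → increasingChain x y x≤y , increasingChain-SatChain x y x≤y)

  labelsFrom : Fin m → Chain → Word
  labelsFrom = labels P ℓ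

  endpoint : Fin m → Chain → Fin m
  endpoint a []       = a
  endpoint a (z ∷ zs) = endpoint z zs

  endpoint-SatChain : ∀ {a zs b} → SatChain P a zs b → endpoint a zs ≡ b
  endpoint-SatChain {zs = []}    refl    = refl
  endpoint-SatChain {zs = _ ∷ _} (_ , s) = endpoint-SatChain s

  length-labelsFrom : ∀ a zs → length (labelsFrom a zs) ≡ length zs
  length-labelsFrom a []       = refl
  length-labelsFrom a (z ∷ zs) = cong suc (length-labelsFrom z zs)

  labelSplit : Fin m → Chain × Chain → Word × Word
  labelSplit a (e , u) = labelsFrom a e , labelsFrom (endpoint a e) u

  map-labelSplit-∷ : ∀ a z qs →
    map (map₁ (ℓ a z ∷_)) (map (labelSplit z) qs) ≡ map (labelSplit a) (map (map₁ (z ∷_)) qs)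
  map-labelSplit-∷ a z qs = trans (sym (Listₚ.map-∘ qs)) (Listₚ.map-∘ qs)

  splits-labelsFrom : ∀ a M → splits (labelsFrom a M) ≡ map (labelSplit a) (splits M)
  splits-labelsFrom a []      = refl
  splits-labelsFrom a (z ∷ M) =
    cong (([] , ℓ a z ∷ labelsFrom z M) ∷_)
         (trans (cong (map (map₁ (ℓ a z ∷_))) (splits-labelsFrom z M)) (map-labelSplit-∷ a z (splits M)))

  splits⁺-labelsFrom : ∀ a M → splits⁺ (labelsFrom a M) ≡ map (labelSplit a) (splits⁺ M)
  splits⁺-labelsFrom a []      = refl
  splits⁺-labelsFrom a (z ∷ M) =
    cong (([] , ℓ a z ∷ labelsFrom z M) ∷_)
         (trans (cong (map (map₁ (ℓ a z ∷_))) (splits⁺-labelsFrom z M)) (map-labelSplit-∷ a z (splits⁺ M)))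

  cuts-labelsFrom : ∀ a M → cuts (labelsFrom a M) ≡ map (labelSplit a) (cuts M)
  cuts-labelsFrom a []      = refl
  cuts-labelsFrom a (z ∷ M) =
    trans (cong (map (map₁ (ℓ a z ∷_))) (splits⁺-labelsFrom z M)) (map-labelSplit-∷ a z (splits⁺ M))

  concatMap-cuts-labelsFrom : ∀ {B : Set} (H : Word × Word → List B) a M →
    concatMap H (cuts (labelsFrom a M))
    ≡ concatMap (λ q → if isNonEmpty (proj₁ q) ∧ isNonEmpty (proj₂ q) then H (labelSplit a q) else []) (splits M)
  concatMap-cuts-labelsFrom H a M = begin
    concatMap H (cuts (labelsFrom a M))              ≡⟨ cong (concatMap H) (cuts-labelsFrom a M) ⟩
    concatMap H (map (labelSplit a) (cuts M))        ≡⟨ Listₚ.concatMap-map H (labelSplit a) (cuts M) ⟩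
    concatMap (H ∘ labelSplit a) (cuts M)            ≡⟨ concatMap-cuts (H ∘ labelSplit a) M ⟨
    concatMap (λ q → if isNonEmpty (proj₁ q) ∧ isNonEmpty (proj₂ q) then H (labelSplit a q) else []) (splits M) ∎
    where open ≡-Reasoning

  sumMap-increasingTail : ∀ {x d} → le x d ≡ true → ∀ z →
    sumMap (λ u → if weakIncᵇ (labelsFrom x u) then z else + 0) (maxChains x d) ≡ z
  sumMap-increasingTail {x} {d} x≤d z =
    trans (sumMap-maxChains-unique u₀ (increasingChain-SatChain x d x≤d) _ others)
          (cong (if_then z else + 0) (Linked⇒weakIncᵇ (increasingChain-increasing x d x≤d)))
    where
    u₀ = increasingChain x d x≤d
    others : ∀ u → SatChain P x u d → u ≢ u₀ → (if weakIncᵇ (labelsFrom x u) then z else + 0) ≡ + 0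
    others u s u≢u₀ with weakIncᵇ (labelsFrom x u) in inc
    ... | false = refl
    ... | true  = ⊥-elim (u≢u₀ (increasingChain-unique x d x≤d u s (weakIncᵇ⇒Linked _ inc)))

  decreasingChainCount : Fin m → Fin m → ℤ
  decreasingChainCount a x = sumMap (λ e → if strictDecᵇ (labelsFrom a e) then + 1 else + 0) (maxChains a x)

  0≤decreasingChainCount : ∀ a x → + 0 ≤ decreasingChainCount a x
  0≤decreasingChainCount a x = 0≤sumMap (maxChains a x)
    where
    0≤sumMap : ∀ es → + 0 ≤ sumMap (λ e → if strictDecᵇ (labelsFrom a e) then + 1 else + 0) es
    0≤sumMap []       = ℤ.+≤+ ℕ.z≤n
    0≤sumMap (e ∷ es) with strictDecᵇ (labelsFrom a e)
    ... | true  = ℤₚ.+-mono-≤ (ℤ.+≤+ ℕ.z≤n) (0≤sumMap es)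
    ... | false = ℤₚ.+-mono-≤ (ℤ.+≤+ ℕ.z≤n) (0≤sumMap es)

  decreasingChainCount-refl : ∀ a → decreasingChainCount a a ≡ + 1
  decreasingChainCount-refl a = sumMap-maxChains-unique {a} {a} [] refl _ λ
    { []      s []≢[] → ⊥-elim ([]≢[] refl)
    ; (w ∷ u) s _     → ⊥-elim (SatChain-∷⇒≢ s refl) }

  -- By uniqueness of increasing maximal chains, the split sum collapses to decreasing chains of [c,x].
  sumOverMiddle-decIncWeight : ∀ h c d →
    sumOverMiddle (λ e u → decIncWeight h (labelSplit c (e , u))) c d
    ≡ sumMap (λ x → if le c x ∧ le x d then h (rk x ∸ rk c) * decreasingChainCount c x else + 0) (elems P)
  sumOverMiddle-decIncWeight h c d = sumMap-cong atMiddle (elems P)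
    where
    atMiddle : ∀ x → sumMap (λ e → sumMap (λ u → decIncWeight h (labelSplit c (e , u))) (maxChains x d)) (maxChains c x)
                     ≡ (if le c x ∧ le x d then h (rk x ∸ rk c) * decreasingChainCount c x else + 0)
    atMiddle x with le c x in c≤x | le x d in x≤d
    ... | false | _     = cong (sumMap _) (maxChains-≰ (false≢true ∘ trans (sym c≤x)))
    ... | true  | false = sumMap-maxChains-vanish {c} {x} _ λ e _ →
      cong (sumMap (λ u → decIncWeight h (labelSplit c (e , u)))) (maxChains-≰ (false≢true ∘ trans (sym x≤d)))
    ... | true  | true  = trans (sumMap-congAll (All.map (λ {e} → viaChain e) (maxChains-SatChain c x)))
                               (sumMap-* (h (rk x ∸ rk c)) _ (maxChains c x))
      where
      viaChain : ∀ e → SatChain P c e x →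
        sumMap (λ u → if strictDecᵇ (labelsFrom c e) ∧ weakIncᵇ (labelsFrom (endpoint c e) u)
                      then h (length (labelsFrom c e)) else + 0) (maxChains x d)
        ≡ h (rk x ∸ rk c) * (if strictDecᵇ (labelsFrom c e) then + 1 else + 0)
      viaChain e s rewrite endpoint-SatChain s | length-labelsFrom c e | length-SatChain s
        with strictDecᵇ (labelsFrom c e)
      ... | true  = trans (sumMap-increasingTail x≤d (h (rk x ∸ rk c))) (sym (ℤₚ.*-identityʳ _))
      ... | false = trans (sumMap-zero (maxChains x d)) (sym (ℤₚ.*-zeroʳ (h (rk x ∸ rk c))))

  sumOverSplits-labels : ∀ (W : Word × Word → ℤ) a b →
    sumMap (λ M → sumMap W (splits (labelsFrom a M))) (maxChains a b) ≡ sumOverSplits (λ e u → W (labelSplit a (e , u))) a b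
  sumOverSplits-labels W a b = sumMap-cong (λ M →
    trans (cong (sumMap W) (splits-labelsFrom a M)) (sumMap-map W (labelSplit a) (splits M))) (maxChains a b)

  signedDecreasingCount : Fin m → Fin m → ℤ
  signedDecreasingCount a x = sign (rk x ∸ rk a) * decreasingChainCount a x

  signedDecreasingCount-cancel : ∀ {c d} → c ≢ d →
    sumMap (λ x → if le c x ∧ le x d then signedDecreasingCount c x else + 0) (elems P) ≡ + 0
  signedDecreasingCount-cancel {c} {d} c≢d = begin
    sumMap (λ x → if le c x ∧ le x d then signedDecreasingCount c x else + 0) (elems P)
      ≡⟨ sumOverMiddle-decIncWeight sign c d ⟨
    sumOverMiddle (λ e u → signedSplit (labelSplit c (e , u))) c d
      ≡⟨ sumOverSplits≡sumOverMiddle _ c d ⟨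
    sumOverSplits (λ e u → signedSplit (labelSplit c (e , u))) c d
      ≡⟨ sumOverSplits-labels signedSplit c d ⟨
    sumMap (λ M → sumMap signedSplit (splits (labelsFrom c M))) (maxChains c d)
      ≡⟨ sumMap-maxChains-vanish {c} {d} _ cancelOnChain ⟩
    + 0
      ∎
    where
    open ≡-Reasoning
    cancelOnChain : ∀ M → SatChain P c M d → sumMap signedSplit (splits (labelsFrom c M)) ≡ + 0
    cancelOnChain []      refl = ⊥-elim (c≢d refl)
    cancelOnChain (z ∷ M) _    = signedSplits-cancel (ℓ c z) (labelsFrom z M)

  möbiusF≡signedDecreasingCount : ∀ f a x → le a x ≡ true → rk x ∸ rk a ℕ.< f →
                                  möbiusF P f a x ≡ signedDecreasingCount a x
  -- The case split goes through an equation because a with-abstraction of eqᵇ P a x would also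
  -- rewrite its hidden occurrences inside signedDecreasingCount a x.
  möbiusF≡signedDecreasingCount (suc f) a x a≤x fuel = byEquality (eqᵇ P a x) refl
    where
    open ≡-Reasoning
    g = signedDecreasingCount a
    below : Fin m → Bool
    below z = le a z ∧ ltᵇ P z x
    S = sumMap (möbiusF P f a) (filterᵇ below (elems P))
    ih : ∀ z → below z ≡ true → möbiusF P f a z ≡ g z
    ih z h with ∧-conicalˡ (le a z) _ h | ltᵇ⇒le∧≢ (∧-conicalʳ (le a z) _ h)
    ... | a≤z | z≤x , z≢x = möbiusF≡signedDecreasingCount f a z a≤z
      (ℕₚ.<-≤-trans (ℕₚ.∸-monoˡ-< (rk-strictMono z≤x z≢x) (rk-mono a≤z)) (ℕₚ.≤-pred fuel))
    atTop : ∀ z → z ≢ x → (if eqᵇ P z x then g z else + 0) ≡ + 0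
    atTop z z≢x rewrite eqᵇ-false z≢x = refl
    interval : ∀ z → (if le a z ∧ le z x then g z else + 0)
                     ≡ (if below z then g z else + 0) + (if eqᵇ P z x then g z else + 0)
    interval z with eqᵇ P z x in z≟x
    ... | true with eqᵇ-true z≟x
    ...   | refl rewrite a≤x | le-refl z = sym (ℤₚ.+-identityˡ _)
    interval z | false rewrite ∧-identityʳ (le z x) = sym (ℤₚ.+-identityʳ _)
    S+g≡0 : a ≢ x → S + g x ≡ + 0
    S+g≡0 a≢x = begin
      S + g x
        ≡⟨ cong (_+ g x) (sumMap-congAll (All.map (λ {z} → ih z) (filterᵇ-All below (elems P)))) ⟩
      sumMap g (filterᵇ below (elems P)) + g x
        ≡⟨ cong₂ _+_ (sumMap-filterᵇ below g (elems P))
                     (sym (trans (sumMap-allFin-delta m _ x atTop) (cong (if_then g x else + 0) (eqᵇ-refl x)))) ⟩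
      sumMap (λ z → if below z then g z else + 0) (elems P) + sumMap (λ z → if eqᵇ P z x then g z else + 0) (elems P)
        ≡⟨ sumMap-+ _ _ (elems P) ⟨
      sumMap (λ z → (if below z then g z else + 0) + (if eqᵇ P z x then g z else + 0)) (elems P)
        ≡⟨ sumMap-cong interval (elems P) ⟨
      sumMap (λ z → if le a z ∧ le z x then g z else + 0) (elems P)
        ≡⟨ signedDecreasingCount-cancel a≢x ⟩
      + 0
        ∎
    byEquality : ∀ b → eqᵇ P a x ≡ b → möbiusF P (suc f) a x ≡ g x
    byEquality true  a≟x = trans (cong (if_then + 1 else (if le a x then - S else + 0)) a≟x)
      (subst (λ y → + 1 ≡ g y) (eqᵇ-true a≟x)
             (sym (cong₂ _*_ (cong sign (ℕₚ.n∸n≡0 (rk a))) (decreasingChainCount-refl a))))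
    byEquality false a≟x = trans (cong (if_then + 1 else (if le a x then - S else + 0)) a≟x)
      (trans (cong (if_then - S else + 0) a≤x)
             (sym (inverseʳ-unique S (g x) (S+g≡0 (eqᵇ-false⇒≢ a≟x)))))

  ∣möbius∣≡decreasingChainCount : ∀ {a x} → le a x ≡ true → + ∣ möbius P a x ∣ ≡ decreasingChainCount a x
  ∣möbius∣≡decreasingChainCount {a} {x} a≤x = begin
    + ∣ möbius P a x ∣
      ≡⟨ cong (+_ ∘ ∣_∣) (möbiusF≡signedDecreasingCount m a x a≤x fuel) ⟩
    + ∣ sign (rk x ∸ rk a) * decreasingChainCount a x ∣
      ≡⟨ cong +_ (ℤₚ.abs-* (sign (rk x ∸ rk a)) _) ⟩
    + (∣ sign (rk x ∸ rk a) ∣ ℕ.* ∣ decreasingChainCount a x ∣)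
      ≡⟨ cong (λ k → + (k ℕ.* ∣ decreasingChainCount a x ∣)) (∣sign∣≡1 (rk x ∸ rk a)) ⟩
    + (1 ℕ.* ∣ decreasingChainCount a x ∣)
      ≡⟨ cong +_ (ℕₚ.*-identityˡ _) ⟩
    + ∣ decreasingChainCount a x ∣
      ≡⟨ ℤₚ.0≤i⇒+∣i∣≡i (0≤decreasingChainCount a x) ⟩
    decreasingChainCount a x
      ∎
    where
    open ≡-Reasoning
    fuel : rk x ∸ rk a ℕ.< m
    fuel = subst (ℕ._< m) (length-SatChain (increasingChain-SatChain a x a≤x))
                 (length-SatChain<m (increasingChain-SatChain a x a≤x))
    ∣sign∣≡1 : ∀ k → ∣ sign k ∣ ≡ 1
    ∣sign∣≡1 zero    = refl
    ∣sign∣≡1 (suc k) = trans (ℤₚ.∣-i∣≡∣i∣ (sign k)) (∣sign∣≡1 k)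

  poinInterval≈poinWords : ∀ c d → poinInterval P G c d ≈ concatMap (poinWord ∘ labelsFrom c) (maxChains c d)
  poinInterval≈poinWords c d = mk≈ λ i j → begin
    coeff (poinInterval P G c d) i j
      ≡⟨ coeff≡sumMap (poinInterval P G c d) i j ⟩
    sumMap (λ t → monoCoeff t i j) (map mono (filterᵇ between (elems P)))
      ≡⟨ sumMap-map _ mono (filterᵇ between (elems P)) ⟩
    sumMap (λ x → monoCoeff (mono x) i j) (filterᵇ between (elems P))
      ≡⟨ sumMap-filterᵇ between _ (elems P) ⟩
    sumMap (λ x → if between x then monoCoeff (mono x) i j else + 0) (elems P)
      ≡⟨ sumMap-cong (byMöbius i j) (elems P) ⟩
    sumMap (λ x → if between x then h i j (rk x ∸ rk c) * decreasingChainCount c x else + 0) (elems P)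
      ≡⟨ sumOverMiddle-decIncWeight (h i j) c d ⟨
    sumOverMiddle (λ e u → decIncWeight (h i j) (labelSplit c (e , u))) c d
      ≡⟨ sumOverSplits≡sumOverMiddle _ c d ⟨
    sumOverSplits (λ e u → decIncWeight (h i j) (labelSplit c (e , u))) c d
      ≡⟨ sumOverSplits-labels (decIncWeight (h i j)) c d ⟨
    sumMap (λ M → sumMap (decIncWeight (h i j)) (splits (labelsFrom c M))) (maxChains c d)
      ≡⟨ sumMap-cong (λ M → trans (coeff-concatMap decIncTerm (splits (labelsFrom c M)) i j)
                                  (sumMap-cong (λ q → coeff-decIncTerm q i j) (splits (labelsFrom c M)))) (maxChains c d) ⟨
    sumMap (λ M → coeff (poinWord (labelsFrom c M)) i j) (maxChains c d)
      ≡⟨ coeff-concatMap (poinWord ∘ labelsFrom c) (maxChains c d) i j ⟨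
    coeff (concatMap (poinWord ∘ labelsFrom c) (maxChains c d)) i j
      ∎
    where
    open ≡-Reasoning
    between : Fin m → Bool
    between x = le c x ∧ le x d
    mono : Fin m → Mono
    mono x = + ∣ möbius P c x ∣ , rk x ∸ rk c , 0
    h : ℕ → ℕ → ℕ → ℤ
    h i j k = monoCoeff (+ 1 , k , 0) i j
    byMöbius : ∀ i j x → (if between x then monoCoeff (mono x) i j else + 0)
                         ≡ (if between x then h i j (rk x ∸ rk c) * decreasingChainCount c x else + 0)
    byMöbius i j x with le c x in c≤x | le x d
    ... | false | _     = refl
    ... | true  | false = refl
    ... | true  | true  rewrite ∣möbius∣≡decreasingChainCount c≤x = monoCoeff-scale _ (rk x ∸ rk c) i j

  numByMaxChains : Fin m → Poly
  numByMaxChains c = concatMap (numWord ∘ labelsFrom c) (maxChains c top)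

  coRank : Fin m → ℕ
  coRank c = n ∸ 1 ∸ rk c

  openIntervalToTop : Fin m → List (Fin m)
  openIntervalToTop c = filterᵇ (λ z → ltᵇ P c z ∧ not (eqᵇ P z top)) (elems P)

  openIntervalToTop-bounds : ∀ {c z} → (ltᵇ P c z ∧ not (eqᵇ P z top)) ≡ true → rk c ℕ.< rk z × z ≢ top
  openIntervalToTop-bounds {c} {z} h with ltᵇ⇒le∧≢ (∧-conicalˡ (ltᵇ P c z) _ h)
  ... | c≤z , c≢z = rk-strictMono c≤z c≢z , λ
    { refl → false≢true (trans (sym (cong not (eqᵇ-refl top))) (∧-conicalʳ (ltᵇ P c top) _ h)) }

  length-tail-SatChain : ∀ {c z M} → SatChain P c (z ∷ M) top → length M ≡ coRank c
  length-tail-SatChain {c} {z} {M} s = begin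
    length M                 ≡⟨ cong (_∸ 1) (length-SatChain s) ⟩
    n ∸ rk c ∸ 1             ≡⟨ ℕₚ.∸-+-assoc n (rk c) 1 ⟩
    n ∸ (rk c ℕ.+ 1)         ≡⟨ cong (n ∸_) (ℕₚ.+-comm (rk c) 1) ⟩
    n ∸ (1 ℕ.+ rk c)         ≡⟨ ℕₚ.∸-+-assoc n 1 (rk c) ⟨
    coRank c                 ∎
    where open ≡-Reasoning

  firstStepTerm : Fin m → Fin m → Poly
  firstStepTerm c z = poinInterval P G c z ⊛ (polyU^ (rk z ∸ rk c ∸ 1) ⊛ (polyT ⊛ numByMaxChains z))

  numByMaxChains-firstCut : ∀ c → c ≢ top → numByMaxChains c
    ≈ poinInterval P G c top ⊛ polyU^ (coRank c)
      ⊕ concatMap (λ M → concatMap (cutTerm poinWord) (cuts (labelsFrom c M))) (maxChains c top)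
  numByMaxChains-firstCut c c≢top = begin
    concatMap (numWord ∘ labelsFrom c) (maxChains c top)
      ≈⟨ concatMap-congAll≈ (All.map (λ {M} → firstCut M) (maxChains-SatChain c top)) ⟩
    concatMap (λ M → poinWord (labelsFrom c M) ⊛ polyU^ (coRank c) ⊕ cutsOf M) (maxChains c top)
      ≈⟨ concatMap-⊕ _ cutsOf (maxChains c top) ⟩
    concatMap (λ M → poinWord (labelsFrom c M) ⊛ polyU^ (coRank c)) (maxChains c top) ⊕ concatMap cutsOf (maxChains c top)
      ≈⟨ ⊕-congˡ _ (⊛-concatMapˡ (poinWord ∘ labelsFrom c) (maxChains c top) (polyU^ (coRank c))) ⟨
    concatMap (poinWord ∘ labelsFrom c) (maxChains c top) ⊛ polyU^ (coRank c) ⊕ concatMap cutsOf (maxChains c top)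
      ≈⟨ ⊕-congˡ _ (⊛-congˡ (polyU^ (coRank c)) (poinInterval≈poinWords c top)) ⟨
    poinInterval P G c top ⊛ polyU^ (coRank c) ⊕ concatMap cutsOf (maxChains c top)
      ∎
    where
    open ≈-Reasoning
    cutsOf : Chain → Poly
    cutsOf M = concatMap (cutTerm poinWord) (cuts (labelsFrom c M))
    firstCut : ∀ M → SatChain P c M top →
               numWord (labelsFrom c M) ≈ poinWord (labelsFrom c M) ⊛ polyU^ (coRank c) ⊕ cutsOf M
    firstCut []      s = ⊥-elim (c≢top s)
    firstCut (z ∷ M) s rewrite sym (trans (length-labelsFrom z M) (length-tail-SatChain s)) =
      numWord-firstCut (ℓ c z) (labelsFrom z M)

  cutTermsThrough≈firstStepTerm : ∀ {c z} → le c z ≡ true →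
    concatMap (λ e → concatMap (λ u → cutTerm poinWord (labelsFrom c e , labelsFrom z u)) (maxChains z top)) (maxChains c z)
    ≈ firstStepTerm c z
  cutTermsThrough≈firstStepTerm {c} {z} c≤z = begin
    concatMap (λ e → concatMap (λ u → cutTerm poinWord (labelsFrom c e , labelsFrom z u)) (maxChains z top)) (maxChains c z)
      ≈⟨ concatMap-congAll≈ (All.map (λ {e} → factor e) (maxChains-SatChain c z)) ⟩
    concatMap (λ e → poinWord (labelsFrom c e) ⊛ R) (maxChains c z)
      ≈⟨ ⊛-concatMapˡ (poinWord ∘ labelsFrom c) (maxChains c z) R ⟨
    concatMap (poinWord ∘ labelsFrom c) (maxChains c z) ⊛ R
      ≈⟨ ⊛-congˡ R (poinInterval≈poinWords c z) ⟨
    firstStepTerm c z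
      ∎
    where
    open ≈-Reasoning
    R = polyU^ (rk z ∸ rk c ∸ 1) ⊛ (polyT ⊛ numByMaxChains z)
    factor : ∀ e → SatChain P c e z →
      concatMap (λ u → poinWord (labelsFrom c e)
                       ⊛ (polyU^ (length (labelsFrom c e) ∸ 1) ⊛ (polyT ⊛ numWord (labelsFrom z u))))
                (maxChains z top)
      ≈ poinWord (labelsFrom c e) ⊛ R
    factor e s rewrite length-labelsFrom c e | length-SatChain s = ≈-sym (begin
      pw ⊛ (polyU^ d ⊛ (polyT ⊛ numByMaxChains z))
        ≈⟨ ⊛-congʳ pw (⊛-congʳ (polyU^ d) (⊛-concatMapʳ polyT (numWord ∘ labelsFrom z) (maxChains z top))) ⟩
      pw ⊛ (polyU^ d ⊛ concatMap (λ u → polyT ⊛ numWord (labelsFrom z u)) (maxChains z top))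
        ≈⟨ ⊛-congʳ pw (⊛-concatMapʳ (polyU^ d) _ (maxChains z top)) ⟩
      pw ⊛ concatMap (λ u → polyU^ d ⊛ (polyT ⊛ numWord (labelsFrom z u))) (maxChains z top)
        ≈⟨ ⊛-concatMapʳ pw _ (maxChains z top) ⟩
      concatMap (λ u → pw ⊛ (polyU^ d ⊛ (polyT ⊛ numWord (labelsFrom z u)))) (maxChains z top)
        ∎)
      where
      pw = poinWord (labelsFrom c e)
      d = rk z ∸ rk c ∸ 1

  cutTerms≈firstStepTerms : ∀ c → c ≢ top →
    concatMap (λ M → concatMap (cutTerm poinWord) (cuts (labelsFrom c M))) (maxChains c top)
    ≈ concatMap (firstStepTerm c) (openIntervalToTop c)
  cutTerms≈firstStepTerms c c≢top = begin
    concatMap (λ M → concatMap (cutTerm poinWord) (cuts (labelsFrom c M))) (maxChains c top)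
      ≡⟨ Listₚ.concatMap-cong (concatMap-cuts-labelsFrom (cutTerm poinWord) c) (maxChains c top) ⟩
    concatOverSplits F c top
      ≈⟨ concatOverSplits≈concatOverMiddle F c top ⟩
    concatOverMiddle F c top
      ≈⟨ concatMap-cong≈ atMiddle (elems P) ⟩
    concatMap (λ x → if inOpenInterval x then firstStepTerm c x else []) (elems P)
      ≡⟨ concatMap-filterᵇ _ (firstStepTerm c) (elems P) ⟨
    concatMap (firstStepTerm c) (openIntervalToTop c)
      ∎
    where
    open ≈-Reasoning
    F : Chain → Chain → Poly
    F e u = if isNonEmpty e ∧ isNonEmpty u then cutTerm poinWord (labelSplit c (e , u)) else []
    inOpenInterval : Fin m → Bool
    inOpenInterval x = ltᵇ P c x ∧ not (eqᵇ P x top)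
    notInOpenInterval : ∀ x → inOpenInterval x ≢ true → (if inOpenInterval x then firstStepTerm c x else []) ≡ []
    notInOpenInterval x h = cong (if_then firstStepTerm c x else []) (¬-not h)
    atMiddle : ∀ x → concatMap (λ e → concatMap (F e) (maxChains x top)) (maxChains c x)
                     ≈ (if inOpenInterval x then firstStepTerm c x else [])
    atMiddle x = byCases (le c x) refl (c Finₚ.≟ x) (x Finₚ.≟ top)
      where
      byCases : ∀ b → le c x ≡ b → Dec (c ≡ x) → Dec (x ≡ top) →
                concatMap (λ e → concatMap (F e) (maxChains x top)) (maxChains c x)
                ≈ (if inOpenInterval x then firstStepTerm c x else [])
      byCases false c≰x _ _ = ≈-trans (≡⇒≈ (cong (concatMap _) (maxChains-≰ (false≢true ∘ trans (sym c≰x)))))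
        (≡⇒≈ (sym (notInOpenInterval x λ h →
          false≢true (trans (sym c≰x) (∧-conicalˡ (le c x) _ (∧-conicalˡ (ltᵇ P c x) _ h))))))
      byCases true c≤x (yes refl) _ = ≈-trans (concatMap-vanish (All.map (λ {e} → emptyHead e) (maxChains-SatChain c c)))
        (≡⇒≈ (sym (notInOpenInterval c λ h → proj₂ (ltᵇ⇒le∧≢ (∧-conicalˡ (ltᵇ P c c) _ h)) refl)))
        where
        emptyHead : ∀ e → SatChain P c e c → concatMap (F e) (maxChains c top) ≈ []
        emptyHead []      _ = concatMap-vanish (All.tabulate {xs = maxChains c top} (λ _ → ≈-refl))
        emptyHead (w ∷ e) s = ⊥-elim (SatChain-∷⇒≢ s refl)
      byCases true c≤x (no c≢x) (yes refl) = ≈-trans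
        (concatMap-vanish (All.tabulate {xs = maxChains c top} λ {e} _ →
          concatMap-vanish (All.map (λ {u} → emptyTail e u) (maxChains-SatChain top top))))
        (≡⇒≈ (sym (notInOpenInterval top λ h → proj₂ (openIntervalToTop-bounds h) refl)))
        where
        emptyTail : ∀ e u → SatChain P top u top → F e u ≈ []
        emptyTail e []      _ rewrite ∧-zeroʳ (isNonEmpty e) = ≈-refl
        emptyTail e (w ∷ u) s = ⊥-elim (SatChain-∷⇒≢ s refl)
      byCases true c≤x (no c≢x) (no x≢top) = ≈-trans
        (concatMap-congAll≈ (All.map (λ {e} s →
            concatMap-congAll≈ (All.map (λ {u} → cutTermAt e s u) (maxChains-SatChain x top)))
          (maxChains-SatChain c x)))
        (≈-trans (cutTermsThrough≈firstStepTerm c≤x)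
                 (≡⇒≈ (cong (if_then firstStepTerm c x else [])
                   (sym (cong₂ _∧_ (cong₂ _∧_ c≤x (cong not (eqᵇ-false c≢x))) (cong not (eqᵇ-false x≢top)))))))
        where
        cutTermAt : ∀ e → SatChain P c e x → ∀ u → SatChain P x u top →
                    F e u ≈ cutTerm poinWord (labelsFrom c e , labelsFrom x u)
        cutTermAt []      s _       _  = ⊥-elim (c≢x s)
        cutTermAt (w ∷ e) s []      s′ = ⊥-elim (x≢top s′)
        cutTermAt (w ∷ e) s (v ∷ u) _  rewrite endpoint-SatChain s = ≈-refl

  numByMaxChains-recursion : ∀ c → c ≢ top →
    numByMaxChains c ≈ poinInterval P G c top ⊛ polyU^ (coRank c) ⊕ concatMap (firstStepTerm c) (openIntervalToTop c)
  numByMaxChains-recursion c c≢top =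
    ≈-trans (numByMaxChains-firstCut c c≢top) (⊕-congʳ _ (cutTerms≈firstStepTerms c c≢top))

  numTerm : Fin m → List (Fin m) → Poly
  numTerm c C = poinChainFrom P G c C ⊛ (polyPow polyT (length C) ⊛ polyU^ (coRank c ∸ length C))

  numFrom : ℕ → Fin m → Poly
  numFrom f c = concatMap (numTerm c) (chainsAboveF P G f c)

  <⇒≤∸1 : ∀ {a b} → a ℕ.< b → a ℕ.≤ b ∸ 1
  <⇒≤∸1 (ℕ.s≤s a≤b) = a≤b

  chainsAboveF-bound : ∀ f z → rk z ℕ.≤ n ∸ 1 →
                       All (λ C → rk z ℕ.+ length C ℕ.≤ n ∸ 1) (chainsAboveF P G f z)
  chainsAboveF-bound zero    z rz≤ = subst (ℕ._≤ n ∸ 1) (sym (ℕₚ.+-identityʳ _)) rz≤ ∷ []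
  chainsAboveF-bound (suc f) z rz≤ = subst (ℕ._≤ n ∸ 1) (sym (ℕₚ.+-identityʳ _)) rz≤ ∷
    Allₚ.concat⁺ (Allₚ.map⁺ (All.map (λ {z′} above → Allₚ.map⁺ (All.map (λ {C} → extend {z′} {C} above)
      (chainsAboveF-bound f z′ (<⇒≤∸1 (rk<n (proj₂ (openIntervalToTop-bounds above)))))))
      (filterᵇ-All _ (elems P))))
    where
    extend : ∀ {z′ C} → (ltᵇ P z z′ ∧ not (eqᵇ P z′ top)) ≡ true →
             rk z′ ℕ.+ length C ℕ.≤ n ∸ 1 → rk z ℕ.+ suc (length C) ℕ.≤ n ∸ 1
    extend {z′} {C} above bound = ℕₚ.≤-trans (ℕₚ.≤-reflexive (ℕₚ.+-suc (rk z) (length C)))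
      (ℕₚ.≤-trans (ℕₚ.+-monoˡ-≤ (length C) (proj₁ (openIntervalToTop-bounds above))) bound)

  ∸-split : ∀ N a b k → a ℕ.< b → b ℕ.+ k ℕ.≤ N → (N ∸ a) ∸ suc k ≡ (b ∸ a ∸ 1) ℕ.+ ((N ∸ b) ∸ k)
  ∸-split N a b k a<b b+k≤N with ℕₚ.m≤n⇒∃[o]m+o≡n a<b | ℕₚ.m≤n⇒∃[o]m+o≡n b+k≤N
  ... | d , refl | r , refl = begin
    (suc a ℕ.+ d ℕ.+ k ℕ.+ r ∸ a) ∸ suc k
      ≡⟨ cong (λ t → (t ∸ a) ∸ suc k) (shape₁ a d k r) ⟩
    (a ℕ.+ suc (k ℕ.+ (d ℕ.+ r)) ∸ a) ∸ suc k
      ≡⟨ cong (_∸ suc k) (ℕₚ.m+n∸m≡n a _) ⟩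
    suc (k ℕ.+ (d ℕ.+ r)) ∸ suc k
      ≡⟨ ℕₚ.m+n∸m≡n k (d ℕ.+ r) ⟩
    d ℕ.+ r
      ≡⟨ cong₂ ℕ._+_ gap rest ⟨
    (suc a ℕ.+ d ∸ a ∸ 1) ℕ.+ ((suc a ℕ.+ d ℕ.+ k ℕ.+ r ∸ (suc a ℕ.+ d)) ∸ k)
      ∎
    where
    open ≡-Reasoning
    shape₁ : ∀ a d k r → suc a ℕ.+ d ℕ.+ k ℕ.+ r ≡ a ℕ.+ suc (k ℕ.+ (d ℕ.+ r))
    shape₁ = ℕ-solve-∀
    gap : suc a ℕ.+ d ∸ a ∸ 1 ≡ d
    gap = cong (_∸ 1) (trans (cong (_∸ a) (sym (ℕₚ.+-suc a d))) (ℕₚ.m+n∸m≡n a (suc d)))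
    rest : (suc a ℕ.+ d ℕ.+ k ℕ.+ r ∸ (suc a ℕ.+ d)) ∸ k ≡ r
    rest = trans (cong (_∸ k) (trans (cong (_∸ (suc a ℕ.+ d)) (ℕₚ.+-assoc (suc a ℕ.+ d) k r))
                                     (ℕₚ.m+n∸m≡n (suc a ℕ.+ d) (k ℕ.+ r))))
                 (ℕₚ.m+n∸m≡n k r)

  numTerm-∷ : ∀ c z C → rk c ℕ.< rk z → rk z ℕ.+ length C ℕ.≤ n ∸ 1 →
    numTerm c (z ∷ C) ≈ poinInterval P G c z ⊛ (polyU^ (rk z ∸ rk c ∸ 1) ⊛ (polyT ⊛ numTerm z C))
  numTerm-∷ c z C rc<rz bound rewrite ∸-split (n ∸ 1) (rk c) (rk z) (length C) rc<rz bound = begin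
    (A ⊛ B) ⊛ ((polyT ⊛ T^) ⊛ polyU^ (d ℕ.+ e))
      ≈⟨ ⊛-assoc A B _ ⟩
    A ⊛ (B ⊛ ((polyT ⊛ T^) ⊛ polyU^ (d ℕ.+ e)))
      ≈⟨ ⊛-congʳ A (⊛-congʳ B (⊛-congʳ (polyT ⊛ T^) (polyPow-+ polyU d e))) ⟩
    A ⊛ (B ⊛ ((polyT ⊛ T^) ⊛ (polyU^ d ⊛ polyU^ e)))
      ≈⟨ ⊛-congʳ A (⊛-congʳ B (⊛-assoc polyT T^ _)) ⟩
    A ⊛ (B ⊛ (polyT ⊛ (T^ ⊛ (polyU^ d ⊛ polyU^ e))))
      ≈⟨ ⊛-congʳ A (⊛-congʳ B (⊛-congʳ polyT (⊛-leftComm T^ (polyU^ d) (polyU^ e)))) ⟩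
    A ⊛ (B ⊛ (polyT ⊛ (polyU^ d ⊛ (T^ ⊛ polyU^ e))))
      ≈⟨ ⊛-congʳ A (⊛-congʳ B (⊛-leftComm polyT (polyU^ d) _)) ⟩
    A ⊛ (B ⊛ (polyU^ d ⊛ (polyT ⊛ (T^ ⊛ polyU^ e))))
      ≈⟨ ⊛-congʳ A (⊛-leftComm B (polyU^ d) _) ⟩
    A ⊛ (polyU^ d ⊛ (B ⊛ (polyT ⊛ (T^ ⊛ polyU^ e))))
      ≈⟨ ⊛-congʳ A (⊛-congʳ (polyU^ d) (⊛-leftComm B polyT _)) ⟩
    A ⊛ (polyU^ d ⊛ (polyT ⊛ (B ⊛ (T^ ⊛ polyU^ e))))
      ∎
    where
    open ≈-Reasoning
    A = poinInterval P G c z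
    B = poinChainFrom P G z C
    T^ = polyPow polyT (length C)
    d = rk z ∸ rk c ∸ 1
    e = coRank z ∸ length C

  numFrom-recursion : ∀ f c → numFrom (suc f) c
    ≈ poinInterval P G c top ⊛ polyU^ (coRank c)
      ⊕ concatMap (λ z → poinInterval P G c z ⊛ (polyU^ (rk z ∸ rk c ∸ 1) ⊛ (polyT ⊛ numFrom f z))) (openIntervalToTop c)
  numFrom-recursion f c = ⊕-cong (⊛-congʳ (poinInterval P G c top) (⊛-identityˡ _)) (begin
    concatMap (numTerm c) (concatMap (λ z → map (z ∷_) (chainsAboveF P G f z)) (openIntervalToTop c))
      ≡⟨ concatMap-concatMap (numTerm c) _ (openIntervalToTop c) ⟩
    concatMap (λ z → concatMap (numTerm c) (map (z ∷_) (chainsAboveF P G f z))) (openIntervalToTop c)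
      ≈⟨ concatMap-congAll≈ (All.map (λ {z} → viaFirstStep z) (filterᵇ-All _ (elems P))) ⟩
    concatMap (λ z → poinInterval P G c z ⊛ (polyU^ (rk z ∸ rk c ∸ 1) ⊛ (polyT ⊛ numFrom f z))) (openIntervalToTop c)
      ∎)
    where
    open ≈-Reasoning
    concatMap-concatMap : ∀ {A B C : Set} (g : B → List C) (h : A → List B) xs →
                          concatMap g (concatMap h xs) ≡ concatMap (λ x → concatMap g (h x)) xs
    concatMap-concatMap g h []       = refl
    concatMap-concatMap g h (x ∷ xs) =
      trans (Listₚ.concatMap-++ g (h x) (concatMap h xs)) (cong (concatMap g (h x) ++_) (concatMap-concatMap g h xs))
    viaFirstStep : ∀ z → (ltᵇ P c z ∧ not (eqᵇ P z top)) ≡ true →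
      concatMap (numTerm c) (map (z ∷_) (chainsAboveF P G f z))
      ≈ poinInterval P G c z ⊛ (polyU^ (rk z ∸ rk c ∸ 1) ⊛ (polyT ⊛ numFrom f z))
    viaFirstStep z above = begin
      concatMap (numTerm c) (map (z ∷_) (chainsAboveF P G f z))
        ≡⟨ Listₚ.concatMap-map (numTerm c) (z ∷_) (chainsAboveF P G f z) ⟩
      concatMap (numTerm c ∘ (z ∷_)) (chainsAboveF P G f z)
        ≈⟨ concatMap-congAll≈ (All.map (λ {C} → numTerm-∷ c z C (proj₁ (openIntervalToTop-bounds above)))
             (chainsAboveF-bound f z (<⇒≤∸1 (rk<n (proj₂ (openIntervalToTop-bounds above)))))) ⟩
      concatMap (λ C → A ⊛ (U ⊛ (polyT ⊛ numTerm z C))) (chainsAboveF P G f z)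
        ≈⟨ ⊛-concatMapʳ A _ (chainsAboveF P G f z) ⟨
      A ⊛ concatMap (λ C → U ⊛ (polyT ⊛ numTerm z C)) (chainsAboveF P G f z)
        ≈⟨ ⊛-congʳ A (⊛-concatMapʳ U _ (chainsAboveF P G f z)) ⟨
      A ⊛ (U ⊛ concatMap (λ C → polyT ⊛ numTerm z C) (chainsAboveF P G f z))
        ≈⟨ ⊛-congʳ A (⊛-congʳ U (⊛-concatMapʳ polyT (numTerm z) (chainsAboveF P G f z))) ⟨
      A ⊛ (U ⊛ (polyT ⊛ numFrom f z))
        ∎
      where
      A = poinInterval P G c z
      U = polyU^ (rk z ∸ rk c ∸ 1)

  numFrom≈numByMaxChains : ∀ f c → c ≢ top → n ∸ rk c ℕ.≤ suc f → numFrom f c ≈ numByMaxChains c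
  numFrom≈numByMaxChains zero c c≢top fuel = ≈-sym (begin
    numByMaxChains c
      ≈⟨ numByMaxChains-recursion c c≢top ⟩
    poinInterval P G c top ⊛ polyU^ (coRank c) ⊕ concatMap (firstStepTerm c) (openIntervalToTop c)
      ≈⟨ ⊕-congʳ _ (concatMap-vanish (All.map (λ {z} → ⊥-elim ∘ noRoom z) (filterᵇ-All _ (elems P)))) ⟩
    poinInterval P G c top ⊛ polyU^ (coRank c) ⊕ []
      ≈⟨ ⊕-congˡ [] (⊛-congʳ (poinInterval P G c top) (⊛-identityˡ _)) ⟨
    numFrom zero c
      ∎)
    where
    open ≈-Reasoning
    noRoom : ∀ z → (ltᵇ P c z ∧ not (eqᵇ P z top)) ≡ true → ⊥
    noRoom z above with openIntervalToTop-bounds above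
    ... | rc<rz , z≢top = ℕₚ.<⇒≱ (ℕₚ.<-≤-trans (ℕ.s≤s rc<rz) (rk<n z≢top))
      (ℕₚ.≤-trans (ℕₚ.m≤n+m∸n n (rk c))
                  (ℕₚ.≤-trans (ℕₚ.+-monoʳ-≤ (rk c) fuel) (ℕₚ.≤-reflexive (ℕₚ.+-comm (rk c) 1))))
  numFrom≈numByMaxChains (suc f) c c≢top fuel = begin
    numFrom (suc f) c
      ≈⟨ numFrom-recursion f c ⟩
    poinInterval P G c top ⊛ polyU^ (coRank c)
      ⊕ concatMap (λ z → poinInterval P G c z ⊛ (polyU^ (rk z ∸ rk c ∸ 1) ⊛ (polyT ⊛ numFrom f z))) (openIntervalToTop c)
      ≈⟨ ⊕-congʳ _ (concatMap-congAll≈ (All.map (λ {z} → byInduction z) (filterᵇ-All _ (elems P)))) ⟩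
    poinInterval P G c top ⊛ polyU^ (coRank c) ⊕ concatMap (firstStepTerm c) (openIntervalToTop c)
      ≈⟨ numByMaxChains-recursion c c≢top ⟨
    numByMaxChains c
      ∎
    where
    open ≈-Reasoning
    fuel′ : n ∸ suc (rk c) ℕ.≤ suc f
    fuel′ = ℕₚ.≤-trans
      (ℕₚ.≤-reflexive (sym (trans (ℕₚ.∸-+-assoc n (rk c) 1) (cong (n ∸_) (ℕₚ.+-comm (rk c) 1)))))
      (ℕₚ.∸-monoˡ-≤ 1 fuel)
    byInduction : ∀ z → (ltᵇ P c z ∧ not (eqᵇ P z top)) ≡ true →
      poinInterval P G c z ⊛ (polyU^ (rk z ∸ rk c ∸ 1) ⊛ (polyT ⊛ numFrom f z)) ≈ firstStepTerm c z
    byInduction z above with openIntervalToTop-bounds above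
    ... | rc<rz , z≢top = ⊛-congʳ (poinInterval P G c z) (⊛-congʳ (polyU^ (rk z ∸ rk c ∸ 1)) (⊛-congʳ polyT
      (numFrom≈numByMaxChains f z z≢top (ℕₚ.≤-trans (ℕₚ.∸-monoʳ-≤ n rc<rz) fuel′))))

  NonNeg-poinInterval : ∀ c d → NonNeg (poinInterval P G c d)
  NonNeg-poinInterval c d = Allₚ.map⁺ (All.tabulate (λ _ → ℤ.+≤+ ℕ.z≤n))

  NonNeg-poinChainFrom : ∀ c C → NonNeg (poinChainFrom P G c C)
  NonNeg-poinChainFrom c []      = NonNeg-poinInterval c top
  NonNeg-poinChainFrom c (d ∷ C) = NonNeg-⊛ (NonNeg-poinInterval c d) (NonNeg-poinChainFrom d C)

  -- When 0̂ = 1̂ the truncated exponent n ∸ 1 ∸ #C is 0, so each summand of Num has nonnegative factors.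
  NonNeg-Num-rank0 : bot ≡ top → NonNeg (Num P G)
  NonNeg-Num-rank0 bot≡top = NonNeg-concatMap term (chainsAboveF P G m bot)
    where
    n≡0 : n ≡ 0
    n≡0 = trans (cong rk (sym bot≡top)) rk-bot
    term : ∀ C → NonNeg (poinChain P G C ⊛ (polyPow polyT (length C) ⊛ polyPow polyOneMinusT (n ∸ 1 ∸ length C)))
    term C rewrite n≡0 | ℕₚ.0∸n≡0 (length C) =
      NonNeg-⊛ (NonNeg-poinChainFrom bot C) (NonNeg-⊛ (NonNeg-polyPow NonNeg-polyT (length C)) NonNeg-polyOne)

  Num≡numFrom : Num P G ≡ numFrom m bot
  Num≡numFrom = Listₚ.concatMap-cong (λ C → cong (λ r → poinChainFrom P G bot C ⊛
    (polyPow polyT (length C) ⊛ polyU^ (n ∸ 1 ∸ r ∸ length C))) (sym rk-bot)) (chainsAboveF P G m bot)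

  n<m : n ℕ.< m
  n<m = subst (ℕ._< m) (rk-chain top _ (increasingChain-SatChain bot top (bot-min top)))
              (length-SatChain<m (increasingChain-SatChain bot top (bot-min top)))

  NonNeg-numByMaxChains : ∀ c → NonNeg (numByMaxChains c)
  NonNeg-numByMaxChains c = NonNeg-concatMap (NonNeg-numWord ∘ labelsFrom c) (maxChains c top)

  0≤coeff-Num : ∀ a b → + 0 ≤ coeff (Num P G) a b
  0≤coeff-Num a b with bot Finₚ.≟ top
  ... | yes bot≡top = 0≤coeff (NonNeg-Num-rank0 bot≡top) a b
  ... | no  bot≢top = begin
    + 0                              ≤⟨ 0≤coeff (NonNeg-numByMaxChains bot) a b ⟩
    coeff (numByMaxChains bot) a b   ≡⟨ coeff-≡ (numFrom≈numByMaxChains m bot bot≢top fuel) a b ⟨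
    coeff (numFrom m bot) a b        ≡⟨ cong (λ p → coeff p a b) Num≡numFrom ⟨
    coeff (Num P G) a b              ∎
    where
    open ℤₚ.≤-Reasoning
    fuel : n ∸ rk bot ℕ.≤ suc m
    fuel = ℕₚ.≤-trans (ℕₚ.m∸n≤m n (rk bot)) (ℕₚ.≤-trans (ℕₚ.<⇒≤ n<m) (ℕₚ.n≤1+n m))

corollary2p16 : (P : FinPoset) (G : Graded P) → RLabeled P →
    ∀ a b → + 0 ≤ coeff (Num P G) a b
corollary2p16 P G (ℓ , isR) = RLabelled.0≤coeff-Num P G ℓ isR
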